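{- Let $d\in\mathbb N$ and $u\in\mathbb C_\infty$ with $\mathbf C_a(u)\neq0$ for all monic $a\in A$ of degree $<d$. Then the $\mathbb F_p$-linear map $\widehat{H_{<d}}(\bullet;u):\mathcal R\to\mathbb C_\infty$, $1\mapsto1$, $x_{\mathbf s}\mapsto H_{<d}(\mathbf s;u)$, is an $\mathbb F_p$-algebra homomorphism from $(\mathcal R,\ast)$; that is, $\widehat{H_{<d}}(x_{\mathbf r}\ast x_{\mathbf s};u)=H_{<d}(\mathbf r;u)H_{<d}(\mathbf s;u)$ for all $\mathbf r,\mathbf s\in\mathbf I$.
   Context: Let $r$ be a power of a prime $p$, $A=\mathbb F_r[\theta]$, $\mathbb C_\infty$ the completion of an algebraic closure of $\mathbb F_r((1/\theta))$; $A_{+,d}$ is the set of monic polynomials of degree $d$. Carlitz module: $a\mapsto\mathbf C_a(X)\in A[X]$, the $\mathbb F_r$-algebra map with $\mathbf C_\theta(X)=\theta X+X^r$; $[a]_u=\mathbf C_a(u)/u$. $\mathbf I$ is the set of finite tuples of positive integers including $\varnothing$. $H_d(s;u)=\sum_{a\in A_{+,d}}[a]_u^{ -s}$, $H_{<d}(\mathbf s;u)=\sum_{d>d_1>\cdots>d_m\ge0}\prod_jH_{d_j}(s_j;u)$ for $\mathbf s=(s_1,\dots,s_m)\neq\varnothing$, $H_{<d}(\varnothing;u)=1$. The $r$-shuffle algebra $(\mathcal R,\ast)$: $\mathcal R$ is the $\mathbb F_p$-vector space on the free monoid on $x_k$ ($k\in\mathbb N$), $x_{\mathbf s}=x_{s_1}\cdots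 x_{s_m}$, $x_\varnothing=1$, $\mathbf s^-=(s_2,\dots,s_m)$; for $r_1,s_1\in\mathbb N$ and positive $i,j$, $\Delta^{i,j}_{r_1,s_1}=(-1)^{r_1-1}\binom{j-1}{r_1-1}+(-1)^{s_1-1}\binom{j-1}{s_1-1}$ if $(r-1)\mid j$, else $0$ (mod $p$); $\ast$ is $\mathbb F_p$-bilinear with $1\ast x_{\mathbf s}=x_{\mathbf s}\ast1=x_{\mathbf s}$ and, for non-empty $\mathbf r,\mathbf s$, $x_{\mathbf r}\ast x_{\mathbf s}=x_{r_1}(x_{\mathbf r^- }\ast x_{\mathbf s})+x_{s_1}(x_{\mathbf r}\ast x_{\mathbf s^- })+x_{r_1+s_1}(x_{\mathbf r^- }\ast x_{\mathbf s^- })+\sum_{i+j=r_1+s_1}\Delta^{i,j}_{r_1,s_1}x_i((x_{\mathbf r^- }\ast x_{\mathbf s^- })\ast x_j)$ (recursion on total depth; juxtaposition is concatenation). -}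

module Defs where

open import Level using (Level; _⊔_) renaming (suc to lsuc)
open import Algebra.Bundles using (CommutativeRing)
open import Data.Nat as ℕ using (ℕ; zero; suc; _∸_; _<_)
open import Data.Nat.Divisibility using (_∣?_)
open import Data.Nat.Combinatorics using (_C_)
open import Data.Integer as ℤ using (ℤ; +_; -[1+_])
open import Data.Fin using (Fin)
open import Data.Vec using (Vec; []; _∷_; lookup)
open import Data.List as List using (List; []; _∷_; _++_; length; map; concatMap)
open import Data.Product using (_×_; _,_)
open import Relation.Nullary using (¬_; yes; no)

record Field (c ℓ : Level) : Set (lsuc (c ⊔ ℓ)) where
  field
    commutativeRing : CommutativeRing c ℓ
  open CommutativeRing commutativeRing public
  field
    _⁻¹      : Carrier → Carrier
    ⁻¹-cong  : ∀ {x y} → x ≈ y → x ⁻¹ ≈ y ⁻¹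
    ⁻¹-inv   : ∀ x → ¬ (x ≈ 0#) → x * (x ⁻¹) ≈ 1#
    0⁻¹      : 0# ⁻¹ ≈ 0#
    0≉1      : ¬ (0# ≈ 1#)

-- Elements of the r-shuffle algebra R: finite formal Z-linear
-- combinations of words x_{s_1}...x_{s_m} (words = List ℕ).
-- Coefficients are read modulo p.

Word : Set
Word = List ℕ

Lin : Set
Lin = List (ℤ × Word)

scaleL : ℤ → Lin → Lin
scaleL c = map (λ { (a , w) → (c ℤ.* a , w) })

prependL : ℕ → Lin → Lin
prependL k = map (λ { (a , w) → (a , k ∷ w) })

sgn : ℕ → ℤ
sgn zero          = + 1
sgn (suc zero)    = ℤ.- (+ 1)
sgn (suc (suc n)) = sgn n

-- Δ^{i,j}_{r₁,s₁} (which only depends on j, r₁, s₁), for field size r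
Δ : (r r₁ s₁ j : ℕ) → ℤ
Δ r r₁ s₁ j with (r ∸ 1) ∣? j
... | yes _ = sgn (r₁ ∸ 1) ℤ.* (+ ((j ∸ 1) C (r₁ ∸ 1)))
              ℤ.+ sgn (s₁ ∸ 1) ℤ.* (+ ((j ∸ 1) C (s₁ ∸ 1)))
... | no  _ = + 0

splits : ℕ → List (ℕ × ℕ)
splits n = map (λ i → (suc i , n ∸ suc i)) (List.upTo (n ∸ 1))

mutual
  shW : (r : ℕ) → ℕ → Word → Word → Lin
  shW r _ [] s = (+ 1 , s) ∷ []
  shW r _ (r₁ ∷ r⁻) [] = (+ 1 , r₁ ∷ r⁻) ∷ []
  shW r zero (_ ∷ _) (_ ∷ _) = []
  shW r (suc f) (r₁ ∷ r⁻) (s₁ ∷ s⁻) =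
       prependL r₁ (shW r f r⁻ (s₁ ∷ s⁻))
    ++ prependL s₁ (shW r f (r₁ ∷ r⁻) s⁻)
    ++ prependL (r₁ ℕ.+ s₁) (shW r f r⁻ s⁻)
    ++ concatMap
         (λ { (i , j) → scaleL (Δ r r₁ s₁ j)
                          (prependL i (shL r f (shW r f r⁻ s⁻) (j ∷ []))) })
         (splits (r₁ ℕ.+ s₁))

  shL : (r : ℕ) → ℕ → Lin → Word → Lin
  shL r f [] v = []
  shL r f ((c , w) ∷ L) v = scaleL c (shW r f w v) ++ shL r f L v

-- x_r ∗ x_s in R (fuel = total depth, which suffices)
_∗[_]_ : Word → ℕ → Word → Lin
rr ∗[ r ] ss = shW r (length rr ℕ.+ length ss) rr ss

-- Carlitz module and the multiple harmonic sums H_{<d}(s;u), in a field K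
-- containing F_r (given by an injective enumeration F : Fin r → K)
-- and θ.

module Carlitz {c ℓ} (K : Field c ℓ) where
  open Field K

  infixr 8 _↑_
  _↑_ : Carrier → ℕ → Carrier
  x ↑ zero  = 1#
  x ↑ suc n = x * (x ↑ n)

  _×1 : ℕ → Carrier
  zero ×1  = 0#
  suc n ×1 = 1# + (n ×1)

  ℤ→K : ℤ → Carrier
  ℤ→K (+ n)    = n ×1
  ℤ→K -[1+ n ] = - (suc n ×1)

  Σl : List Carrier → Carrier
  Σl = List.foldr _+_ 0#

  Σ< : ℕ → (ℕ → Carrier) → Carrier
  Σ< zero    g = 0#
  Σ< (suc n) g = Σ< n g + g n

  allVecs : (r n : ℕ) → List (Vec (Fin r) n)
  allVecs r zero    = [] ∷ []
  allVecs r (suc n) =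
    concatMap (λ x → map (x ∷_) (allVecs r n)) (List.allFin r)

  module _ (r : ℕ) (F : Fin r → Carrier) (θ : Carrier) where

    coeffAt : ∀ {n} → Vec (Fin r) n → ℕ → Carrier
    coeffAt []       _       = 0#
    coeffAt (x ∷ xs) zero    = F x
    coeffAt (x ∷ xs) (suc i) = coeffAt xs i

    evalPoly : ∀ {n} → Vec (Fin r) n → Carrier
    evalPoly {n} cs = Σ< n (λ i → coeffAt cs i * θ ↑ i)

    Cθ^ : ℕ → Carrier → Carrier
    Cθ^ zero    u = u
    Cθ^ (suc i) u = θ * Cθ^ i u + (Cθ^ i u) ↑ r

    -- C_a(u) for the monic a = θ^d + Σ_{i<d} F(c_i) θ^i   (cs = (c_0..c_{d-1}))
    Cmonic : ∀ {d} → Vec (Fin r) d → Carrier → Carrier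
    Cmonic {d} cs u = Cθ^ d u + Σ< d (λ i → coeffAt cs i * Cθ^ i u)

    bracket : ∀ {d} → Vec (Fin r) d → Carrier → Carrier
    bracket cs u = Cmonic cs u * (u ⁻¹)

    H : ℕ → ℕ → Carrier → Carrier
    H d s u = Σl (map (λ cs → (bracket cs u ⁻¹) ↑ s) (allVecs r d))

    -- H_{<d}(s;u) = Σ_{d > d_1 > ... > d_m ≥ 0} Π_j H_{d_j}(s_j;u)
    Hlt : ℕ → Word → Carrier → Carrier
    Hlt d []       u = 1#
    Hlt d (s ∷ s⁻) u = Σ< d (λ d₁ → H d₁ s u * Hlt d₁ s⁻ u)

    Hhat : ℕ → Lin → Carrier → Carrier
    Hhat d L u = Σl (map (λ { (a , w) → ℤ→K a * Hlt d w u }) L)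

{-# OPTIONS --safe #-}
module Submission where

-- Induction on the total depth of the two words and on d.  Passing from d to
-- d + 1 adds H_d(s₁) H_{<d}(s) to H_{<d}(s₁ ∷ s), and these increments match the
-- recursion defining ∗ term by term once one knows the product formula in a
-- single degree,
--   H_d(s₁) H_d(s₂) = H_d(s₁ + s₂) + Σ_{i+j = s₁+s₂} Δ^{i,j}_{s₁,s₂} H_d(i) H_{<d}(j).
-- This comes from the partial fraction expansion of [a]_u^{-s₁} [b]_u^{-s₂} for
-- distinct monic a, b of degree d, which leaves sums Σ_b [b - a]_u^{-j}.  As
-- C_•(u) is 𝔽_r-linear, translating and rescaling coefficients turns such a sum
-- into (Σ_{c ∈ 𝔽_r} c^M) H_{<d}(j) with M ≡ - j (mod r - 1), and that power sum
-- is -1 or 0 according as r - 1 divides j, which is where Δ comes from.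

open import Defs
open import Data.Nat using (ℕ; _<_; _≤_; _^_)
open import Data.Nat.Primality using (Prime)
open import Data.Fin using (Fin)
open import Data.Vec using (Vec; lookup)
open import Data.List.Relation.Unary.All using (All)
open import Relation.Binary.PropositionalEquality using (_≡_)
open import Relation.Nullary using (¬_)

open import Data.Nat as ℕ using (zero; suc; 2+; nonTrivial⇒n>1)
import Data.Nat.Properties as ℕP
open import Data.Nat.Combinatorics using (_C_; nC1≡n; nCn≡1; nCk+nC[k+1]≡[n+1]C[k+1])
open import Data.Nat.Divisibility using (_∣_; _∣?_; divides; m∣m*n; ∣m+n∣m⇒∣n; ∣m∣n⇒∣m+n; ∣m⇒∣m*n; ∣-refl; ∣⇒≤)
open import Data.Nat.Induction using (<-rec)
open import Data.Nat.Primality using (prime⇒nonTrivial; euclidsLemma)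
import Data.Integer as ℤ
import Data.Integer.Properties as ℤP
open import Data.Fin as Fin using (toℕ)
import Data.Fin.Properties as FinP
open import Data.Vec as Vec using ([]; _∷_)
import Data.Vec.Properties as VecP
open import Data.List as List using (List; []; _∷_; _++_; length)
import Data.List.Relation.Unary.All as All
import Data.List.Relation.Unary.All.Properties as AllP
open import Data.Maybe using (Maybe; just; nothing)
open import Data.Product using (Σ; _×_; _,_; proj₁; proj₂)
open import Data.Sum using (inj₁; inj₂)
open import Data.Empty using (⊥-elim)
open import Level using (_⊔_)
open import Relation.Binary.Definitions using (tri<; tri≈; tri>)
open import Relation.Nullary using (yes; no)
import Relation.Binary.PropositionalEquality as Eq
import Algebra.Solver.Ring.AlmostCommutativeRing as ACR

module BinomialDivisibility where
  open import Data.Nat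
  open import Data.Nat.Properties
  open import Data.Nat.Tactic.RingSolver using (solve-∀)
  open import Relation.Binary.PropositionalEquality

  [1+k]*[1+n]C[1+k]≡[1+n]*nCk : ∀ n k → suc k * (suc n C suc k) ≡ suc n * (n C k)
  [1+k]*[1+n]C[1+k]≡[1+n]*nCk zero    zero    = refl
  [1+k]*[1+n]C[1+k]≡[1+n]*nCk zero    (suc k) = *-zeroʳ (suc (suc k))
  [1+k]*[1+n]C[1+k]≡[1+n]*nCk (suc n) zero    =
    trans (+-identityʳ _) (trans (nC1≡n (suc (suc n))) (sym (*-identityʳ _)))
  [1+k]*[1+n]C[1+k]≡[1+n]*nCk (suc n) (suc k) = begin
    suc (suc k) * (suc (suc n) C suc (suc k))
      ≡⟨ cong (suc (suc k) *_) (sym (nCk+nC[k+1]≡[n+1]C[k+1] (suc n) (suc k))) ⟩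
    suc (suc k) * ((suc n C suc k) + (suc n C suc (suc k)))
      ≡⟨ distribute (suc n C suc k) (suc n C suc (suc k)) k ⟩
    (suc n C suc k) + (suc k * (suc n C suc k) + suc (suc k) * (suc n C suc (suc k)))
      ≡⟨ cong₂ (λ a b → (suc n C suc k) + (a + b)) ([1+k]*[1+n]C[1+k]≡[1+n]*nCk n k)
                                                    ([1+k]*[1+n]C[1+k]≡[1+n]*nCk n (suc k)) ⟩
    (suc n C suc k) + (suc n * (n C k) + suc n * (n C suc k))
      ≡⟨ cong ((suc n C suc k) +_) (sym (*-distribˡ-+ (suc n) (n C k) (n C suc k))) ⟩
    (suc n C suc k) + suc n * ((n C k) + (n C suc k))
      ≡⟨ cong (λ a → (suc n C suc k) + suc n * a) (nCk+nC[k+1]≡[n+1]C[k+1] n k) ⟩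
    (suc n C suc k) + suc n * (suc n C suc k) ∎
    where
    open ≡-Reasoning
    distribute : ∀ a b k → suc (suc k) * (a + b) ≡ a + (suc k * a + suc (suc k) * b)
    distribute = solve-∀

  prime∣pCk : ∀ {p} → Prime p → ∀ k → 0 < k → k < p → p ∣ p C k
  prime∣pCk {suc p} p-prime (suc k) _ k<p
    with euclidsLemma (suc k) (suc p C suc k) p-prime
           (divides (p C k) (trans ([1+k]*[1+n]C[1+k]≡[1+n]*nCk p k) (*-comm (suc p) _)))
  ... | inj₂ p∣pCk = p∣pCk
  ... | inj₁ p∣k   = ⊥-elim (<⇒≱ k<p (∣⇒≤ p∣k))

open BinomialDivisibility using (prime∣pCk)

module OverField {c ℓ} (K : Field c ℓ) where

  open ℤ using (ℤ; +_; -[1+_])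
  open Field K public hiding (zero)
  open Carlitz K public
  open import Relation.Binary.Reasoning.Setoid setoid public
  open import Algebra.Properties.Ring ring public
    using (-‿distribʳ-*; -‿involutive; -0#≈0#)
  open import Algebra.Properties.AbelianGroup +-abelianGroup
    using () renaming (⁻¹-∙-comm to -‿+-comm)
  open import Algebra.Properties.Semiring.Exp semiring using () renaming (_^_ to _^ᴷ_)
  open import Algebra.Properties.Semiring.Mult semiring using () renaming (_×_ to _×ᴷ_)
  open import Algebra.Properties.Semiring.Sum semiring using (sum)
  open import Algebra.Properties.Monoid.Sum +-monoid using (sum-init-last; sum-replicate-zero; sum-cong-≋)
  import Algebra.Properties.CommutativeSemiring.Binomial commutativeSemiring as Binomial

  ≈-reflexive : ∀ {x y} → x ≡ y → x ≈ y
  ≈-reflexive Eq.refl = refl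

  ×1-+ : ∀ m n → (m ℕ.+ n) ×1 ≈ m ×1 + n ×1
  ×1-+ zero    n = sym (+-identityˡ _)
  ×1-+ (suc m) n = trans (+-congˡ (×1-+ m n)) (sym (+-assoc _ _ _))

  ×1-* : ∀ m n → (m ℕ.* n) ×1 ≈ m ×1 * n ×1
  ×1-* zero    n = sym (zeroˡ _)
  ×1-* (suc m) n = begin
    (n ℕ.+ m ℕ.* n) ×1      ≈⟨ ×1-+ n (m ℕ.* n) ⟩
    n ×1 + (m ℕ.* n) ×1     ≈⟨ +-cong (sym (*-identityˡ _)) (×1-* m n) ⟩
    1# * n ×1 + m ×1 * n ×1 ≈⟨ sym (distribʳ _ _ _) ⟩
    (1# + m ×1) * n ×1      ∎

  ℤ→K-⊖ : ∀ m n → ℤ→K (m ℤ.⊖ n) ≈ m ×1 - n ×1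
  ℤ→K-⊖ m       zero    = sym (trans (+-congˡ -0#≈0#) (+-identityʳ _))
  ℤ→K-⊖ zero    (suc n) = sym (+-identityˡ _)
  ℤ→K-⊖ (suc m) (suc n) = begin
    ℤ→K (suc m ℤ.⊖ suc n)     ≈⟨ ≈-reflexive (Eq.cong ℤ→K (ℤP.[1+m]⊖[1+n]≡m⊖n m n)) ⟩
    ℤ→K (m ℤ.⊖ n)             ≈⟨ ℤ→K-⊖ m n ⟩
    m ×1 - n ×1               ≈⟨ +-congʳ (sym (+-identityˡ _)) ⟩
    (0# + m ×1) - n ×1        ≈⟨ +-congʳ (+-congʳ (sym (-‿inverseʳ 1#))) ⟩
    ((1# - 1#) + m ×1) - n ×1 ≈⟨ +-congʳ (trans (+-assoc _ _ _) (+-congˡ (+-comm _ _))) ⟩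
    (1# + (m ×1 - 1#)) - n ×1 ≈⟨ trans (+-congʳ (sym (+-assoc _ _ _))) (+-assoc _ _ _) ⟩
    (1# + m ×1) + (- 1# - n ×1) ≈⟨ +-congˡ (-‿+-comm 1# (n ×1)) ⟩
    (1# + m ×1) - (1# + n ×1) ∎

  ℤ→K-neg : ∀ z → ℤ→K (ℤ.- z) ≈ - ℤ→K z
  ℤ→K-neg (+ zero)  = sym -0#≈0#
  ℤ→K-neg (+ suc n) = refl
  ℤ→K-neg -[1+ n ]  = sym (-‿involutive _)

  ℤ→K-+ : ∀ x y → ℤ→K (x ℤ.+ y) ≈ ℤ→K x + ℤ→K y
  ℤ→K-+ (+ m)    (+ n)    = ×1-+ m n
  ℤ→K-+ (+ m)    -[1+ n ] = ℤ→K-⊖ m (suc n)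
  ℤ→K-+ -[1+ m ] (+ n)    = trans (ℤ→K-⊖ n (suc m)) (+-comm _ _)
  ℤ→K-+ -[1+ m ] -[1+ n ] = begin
    - (suc (suc (m ℕ.+ n)) ×1)      ≈⟨ -‿cong (≈-reflexive (Eq.cong (λ k → suc k ×1) (Eq.sym (ℕP.+-suc m n)))) ⟩
    - ((suc m ℕ.+ suc n) ×1)        ≈⟨ -‿cong (×1-+ (suc m) (suc n)) ⟩
    - (suc m ×1 + suc n ×1)         ≈⟨ sym (-‿+-comm _ _) ⟩
    - (suc m ×1) + - (suc n ×1)     ∎

  ℤ→K-*+ : ∀ x n → ℤ→K (x ℤ.* + n) ≈ ℤ→K x * n ×1
  ℤ→K-*+ x zero    = trans (≈-reflexive (Eq.cong ℤ→K (ℤP.*-zeroʳ x))) (sym (zeroʳ _))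
  ℤ→K-*+ x (suc n) = begin
    ℤ→K (x ℤ.* (+ 1 ℤ.+ + n))     ≈⟨ ≈-reflexive (Eq.cong ℤ→K (Eq.trans (ℤP.*-distribˡ-+ x (+ 1) (+ n))
                                                               (Eq.cong (ℤ._+ (x ℤ.* + n)) (ℤP.*-identityʳ x)))) ⟩
    ℤ→K (x ℤ.+ x ℤ.* + n)         ≈⟨ ℤ→K-+ x (x ℤ.* + n) ⟩
    ℤ→K x + ℤ→K (x ℤ.* + n)       ≈⟨ +-cong (sym (*-identityʳ _)) (ℤ→K-*+ x n) ⟩
    ℤ→K x * 1# + ℤ→K x * n ×1     ≈⟨ sym (distribˡ _ _ _) ⟩
    ℤ→K x * (1# + n ×1)           ∎

  ℤ→K-* : ∀ x y → ℤ→K (x ℤ.* y) ≈ ℤ→K x * ℤ→K y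
  ℤ→K-* x (+ n)    = ℤ→K-*+ x n
  ℤ→K-* x -[1+ n ] = begin
    ℤ→K (x ℤ.* ℤ.- (+ suc n))  ≈⟨ ≈-reflexive (Eq.cong ℤ→K (Eq.sym (ℤP.neg-distribʳ-* x (+ suc n)))) ⟩
    ℤ→K (ℤ.- (x ℤ.* + suc n))  ≈⟨ ℤ→K-neg (x ℤ.* + suc n) ⟩
    - ℤ→K (x ℤ.* + suc n)      ≈⟨ -‿cong (ℤ→K-*+ x (suc n)) ⟩
    - (ℤ→K x * suc n ×1)       ≈⟨ -‿distribʳ-* _ _ ⟩
    ℤ→K x * - (suc n ×1)       ∎

  -- Constants for the ring solver: equal to ℤ→K, but sending + 1 to 1# on
  -- the nose (ℤ→K (+ 1) is 1# + 0#), so that solved goals match literally.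
  ×1ᶜ : ℕ → Carrier
  ×1ᶜ zero          = 0#
  ×1ᶜ (suc zero)    = 1#
  ×1ᶜ (suc (suc n)) = 1# + ×1ᶜ (suc n)

  ×1ᶜ≈×1 : ∀ n → ×1ᶜ n ≈ n ×1
  ×1ᶜ≈×1 zero          = refl
  ×1ᶜ≈×1 (suc zero)    = sym (+-identityʳ 1#)
  ×1ᶜ≈×1 (suc (suc n)) = +-congˡ (×1ᶜ≈×1 (suc n))

  ℤ→Kᶜ : ℤ → Carrier
  ℤ→Kᶜ (+ n)    = ×1ᶜ n
  ℤ→Kᶜ -[1+ n ] = - ×1ᶜ (suc n)

  ℤ→Kᶜ≈ℤ→K : ∀ z → ℤ→Kᶜ z ≈ ℤ→K z
  ℤ→Kᶜ≈ℤ→K (+ n)    = ×1ᶜ≈×1 n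
  ℤ→Kᶜ≈ℤ→K -[1+ n ] = -‿cong (×1ᶜ≈×1 (suc n))

  ℤ→Kᶜ-homomorphism : ACR._-Raw-AlmostCommutative⟶_ ℤ.+-*-rawRing (ACR.fromCommutativeRing commutativeRing)
  ℤ→Kᶜ-homomorphism = record
    { ⟦_⟧    = ℤ→Kᶜ
    ; +-homo = λ x y → transport (x ℤ.+ y) (ℤ→K-+ x y) (+-cong (ℤ→Kᶜ≈ℤ→K x) (ℤ→Kᶜ≈ℤ→K y))
    ; *-homo = λ x y → transport (x ℤ.* y) (ℤ→K-* x y) (*-cong (ℤ→Kᶜ≈ℤ→K x) (ℤ→Kᶜ≈ℤ→K y))
    ; -‿homo = λ x → transport (ℤ.- x) (ℤ→K-neg x) (-‿cong (ℤ→Kᶜ≈ℤ→K x))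
    ; 0-homo = refl
    ; 1-homo = refl
    }
    where
    transport : ∀ z {b b′} → ℤ→K z ≈ b → b′ ≈ b → ℤ→Kᶜ z ≈ b′
    transport z z≈b b′≈b = trans (ℤ→Kᶜ≈ℤ→K z) (trans z≈b (sym b′≈b))

  ℤ→Kᶜ-≟ : (x y : ℤ) → Maybe (ℤ→Kᶜ x ≈ ℤ→Kᶜ y)
  ℤ→Kᶜ-≟ x y with x ℤ.≟ y
  ... | yes Eq.refl = just refl
  ... | no _        = nothing

  open import Algebra.Solver.Ring ℤ.+-*-rawRing (ACR.fromCommutativeRing commutativeRing)
                                  ℤ→Kᶜ-homomorphism ℤ→Kᶜ-≟ public
    using (solve; _:+_; _:*_; :-_; _:-_; con; _:=_)

  ↑-cong : ∀ {x y} n → x ≈ y → x ↑ n ≈ y ↑ n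
  ↑-cong zero    _   = refl
  ↑-cong (suc n) x≈y = *-cong x≈y (↑-cong n x≈y)

  ↑-+ : ∀ x m n → x ↑ (m ℕ.+ n) ≈ x ↑ m * x ↑ n
  ↑-+ x zero    n = sym (*-identityˡ _)
  ↑-+ x (suc m) n = trans (*-congˡ (↑-+ x m n)) (sym (*-assoc _ _ _))

  *-↑ : ∀ x y n → (x * y) ↑ n ≈ x ↑ n * y ↑ n
  *-↑ x y zero    = sym (*-identityˡ _)
  *-↑ x y (suc n) = trans (*-congˡ (*-↑ x y n))
    (solve 4 (λ a b c d → (a :* b) :* (c :* d) := (a :* c) :* (b :* d)) refl x y _ _)

  1↑ : ∀ n → 1# ↑ n ≈ 1#
  1↑ zero    = refl
  1↑ (suc n) = trans (*-identityˡ _) (1↑ n)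

  ↑-* : ∀ x m n → x ↑ (m ℕ.* n) ≈ (x ↑ m) ↑ n
  ↑-* x zero    n = sym (1↑ n)
  ↑-* x (suc m) n = begin
    x ↑ (n ℕ.+ m ℕ.* n)     ≈⟨ ↑-+ x n (m ℕ.* n) ⟩
    x ↑ n * x ↑ (m ℕ.* n)   ≈⟨ *-congˡ (↑-* x m n) ⟩
    x ↑ n * (x ↑ m) ↑ n     ≈⟨ sym (*-↑ x (x ↑ m) n) ⟩
    (x * x ↑ m) ↑ n         ∎

  ↑-scaled-cong : ∀ m {w z z′} → w * z ≈ w * z′ → w * z ↑ m ≈ w * z′ ↑ m
  ↑-scaled-cong zero    _        = refl
  ↑-scaled-cong (suc m) {w} {z} {z′} wz≈wz′ = begin
    w * (z * z ↑ m)     ≈⟨ solve 3 (λ a b c → a :* (b :* c) := (a :* b) :* c) refl w z _ ⟩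
    (w * z) * z ↑ m     ≈⟨ *-congʳ wz≈wz′ ⟩
    (w * z′) * z ↑ m    ≈⟨ solve 3 (λ a b c → (a :* b) :* c := b :* (a :* c)) refl w z′ _ ⟩
    z′ * (w * z ↑ m)    ≈⟨ *-congˡ (↑-scaled-cong m wz≈wz′) ⟩
    z′ * (w * z′ ↑ m)   ≈⟨ solve 3 (λ a b c → b :* (a :* c) := a :* (b :* c)) refl w z′ _ ⟩
    w * (z′ * z′ ↑ m)   ∎

  0↑ : ∀ {n} → 1 ≤ n → 0# ↑ n ≈ 0#
  0↑ {suc n} _ = zeroˡ _

  x-y≈0⇒x≈y : ∀ {x y} → x - y ≈ 0# → x ≈ y
  x-y≈0⇒x≈y {x} {y} x-y≈0 = begin
    x           ≈⟨ solve 2 (λ x y → x := (x :- y) :+ y) refl x y ⟩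
    (x - y) + y ≈⟨ +-congʳ x-y≈0 ⟩
    0# + y      ≈⟨ +-identityˡ y ⟩
    y           ∎

  x≈y⇒x-y≈0 : ∀ {x y} → x ≈ y → x - y ≈ 0#
  x≈y⇒x-y≈0 {x} {y} x≈y = trans (+-congʳ x≈y) (-‿inverseʳ y)

  Nonzero : Carrier → Set ℓ
  Nonzero x = ¬ (x ≈ 0#)

  ⁻¹-inverseˡ : ∀ {x} → Nonzero x → x ⁻¹ * x ≈ 1#
  ⁻¹-inverseˡ x≉0 = trans (*-comm _ _) (⁻¹-inv _ x≉0)

  ⁻¹-unique : ∀ {x y} → Nonzero x → x * y ≈ 1# → x ⁻¹ ≈ y
  ⁻¹-unique {x} {y} x≉0 xy≈1 = begin
    x ⁻¹             ≈⟨ sym (*-identityʳ _) ⟩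
    x ⁻¹ * 1#        ≈⟨ *-congˡ (sym xy≈1) ⟩
    x ⁻¹ * (x * y)   ≈⟨ sym (*-assoc _ _ _) ⟩
    (x ⁻¹ * x) * y   ≈⟨ *-congʳ (⁻¹-inverseˡ x≉0) ⟩
    1# * y           ≈⟨ *-identityˡ y ⟩
    y                ∎

  *-cancelˡ-zero : ∀ {x y} → Nonzero x → x * y ≈ 0# → y ≈ 0#
  *-cancelˡ-zero {x} {y} x≉0 xy≈0 = begin
    y                ≈⟨ sym (*-identityˡ y) ⟩
    1# * y           ≈⟨ *-congʳ (sym (⁻¹-inverseˡ x≉0)) ⟩
    (x ⁻¹ * x) * y   ≈⟨ *-assoc _ _ _ ⟩
    x ⁻¹ * (x * y)   ≈⟨ *-congˡ xy≈0 ⟩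
    x ⁻¹ * 0#        ≈⟨ zeroʳ _ ⟩
    0#               ∎

  *-cancelʳ-zero : ∀ {x y} → Nonzero y → x * y ≈ 0# → x ≈ 0#
  *-cancelʳ-zero y≉0 xy≈0 = *-cancelˡ-zero y≉0 (trans (*-comm _ _) xy≈0)

  *-nonzero : ∀ {x y} → Nonzero x → Nonzero y → Nonzero (x * y)
  *-nonzero x≉0 y≉0 xy≈0 = y≉0 (*-cancelˡ-zero x≉0 xy≈0)

  1-nonzero : Nonzero 1#
  1-nonzero 1≈0 = 0≉1 (sym 1≈0)

  ⁻¹-nonzero : ∀ {x} → Nonzero x → Nonzero (x ⁻¹)
  ⁻¹-nonzero {x} x≉0 x⁻¹≈0 = 1-nonzero (trans (sym (⁻¹-inv x x≉0)) (trans (*-congˡ x⁻¹≈0) (zeroʳ _)))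

  -‿nonzero : ∀ {x} → Nonzero x → Nonzero (- x)
  -‿nonzero {x} x≉0 -x≈0 = x≉0 (trans (sym (-‿involutive x)) (trans (-‿cong -x≈0) -0#≈0#))

  ↑-nonzero : ∀ {x} n → Nonzero x → Nonzero (x ↑ n)
  ↑-nonzero zero    _   = 1-nonzero
  ↑-nonzero (suc n) x≉0 = *-nonzero x≉0 (↑-nonzero n x≉0)

  ⁻¹-zero : ∀ {x} → x ≈ 0# → x ⁻¹ ≈ 0#
  ⁻¹-zero x≈0 = trans (⁻¹-cong x≈0) 0⁻¹

  ⁻¹-* : ∀ {x y} → Nonzero x → Nonzero y → (x * y) ⁻¹ ≈ x ⁻¹ * y ⁻¹
  ⁻¹-* {x} {y} x≉0 y≉0 = ⁻¹-unique (*-nonzero x≉0 y≉0) (begin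
    (x * y) * (x ⁻¹ * y ⁻¹)   ≈⟨ solve 4 (λ a b c d → (a :* b) :* (c :* d) := (a :* c) :* (b :* d)) refl x y _ _ ⟩
    (x * x ⁻¹) * (y * y ⁻¹)   ≈⟨ *-cong (⁻¹-inv x x≉0) (⁻¹-inv y y≉0) ⟩
    1# * 1#                   ≈⟨ *-identityˡ 1# ⟩
    1#                        ∎)

  ⁻¹-neg : ∀ {x} → Nonzero x → (- x) ⁻¹ ≈ - (x ⁻¹)
  ⁻¹-neg {x} x≉0 = ⁻¹-unique (-‿nonzero x≉0)
    (trans (solve 2 (λ a b → (:- a) :* (:- b) := a :* b) refl x _) (⁻¹-inv x x≉0))

  ⁻¹-↑ : ∀ {x} n → Nonzero x → (x ↑ n) ⁻¹ ≈ (x ⁻¹) ↑ n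
  ⁻¹-↑ zero    _   = ⁻¹-unique 1-nonzero (*-identityˡ 1#)
  ⁻¹-↑ (suc n) x≉0 = trans (⁻¹-* x≉0 (↑-nonzero n x≉0)) (*-congˡ (⁻¹-↑ n x≉0))

  ⁻¹-scaled-cong : ∀ v {X X′} → Nonzero X → Nonzero X′ → v * X ≈ v * X′ → v * X ⁻¹ ≈ v * X′ ⁻¹
  ⁻¹-scaled-cong v {X} {X′} X≉0 X′≉0 vX≈vX′ = begin
    v * X ⁻¹
      ≈⟨ solve 2 (λ a b → a :* b := (a :* b) :* con (+ 1)) refl v (X ⁻¹) ⟩
    (v * X ⁻¹) * 1#
      ≈⟨ *-congˡ (sym (⁻¹-inv X′ X′≉0)) ⟩
    (v * X ⁻¹) * (X′ * X′ ⁻¹)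
      ≈⟨ solve 4 (λ a b c d → (a :* b) :* (c :* d) := b :* (a :* c) :* d) refl v (X ⁻¹) X′ (X′ ⁻¹) ⟩
    X ⁻¹ * (v * X′) * X′ ⁻¹
      ≈⟨ *-congʳ (*-congˡ (sym vX≈vX′)) ⟩
    X ⁻¹ * (v * X) * X′ ⁻¹
      ≈⟨ solve 4 (λ a b c d → b :* (a :* c) :* d := a :* (b :* c) :* d) refl v (X ⁻¹) X (X′ ⁻¹) ⟩
    v * (X ⁻¹ * X) * X′ ⁻¹
      ≈⟨ *-congʳ (trans (*-congˡ (⁻¹-inverseˡ X≉0)) (*-identityʳ v)) ⟩
    v * X′ ⁻¹ ∎

  ∑ : {A : Set} → List A → (A → Carrier) → Carrier
  ∑ xs f = Σl (List.map f xs)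

  ∑-cong : ∀ {A : Set} (xs : List A) {f g : A → Carrier} → (∀ x → f x ≈ g x) → ∑ xs f ≈ ∑ xs g
  ∑-cong []       f≈g = refl
  ∑-cong (x ∷ xs) f≈g = +-cong (f≈g x) (∑-cong xs f≈g)

  ∑-++ : ∀ {A : Set} (xs ys : List A) (f : A → Carrier) → ∑ (xs ++ ys) f ≈ ∑ xs f + ∑ ys f
  ∑-++ []       ys f = sym (+-identityˡ _)
  ∑-++ (x ∷ xs) ys f = trans (+-congˡ (∑-++ xs ys f)) (sym (+-assoc _ _ _))

  ∑-+ : ∀ {A : Set} (xs : List A) (f g : A → Carrier) → ∑ xs (λ x → f x + g x) ≈ ∑ xs f + ∑ xs g
  ∑-+ []       f g = sym (+-identityˡ _)
  ∑-+ (x ∷ xs) f g = trans (+-congˡ (∑-+ xs f g))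
    (solve 4 (λ a b c d → (a :+ b) :+ (c :+ d) := (a :+ c) :+ (b :+ d)) refl _ _ _ _)

  ∑-*ˡ : ∀ {A : Set} (xs : List A) (a : Carrier) (f : A → Carrier) → ∑ xs (λ x → a * f x) ≈ a * ∑ xs f
  ∑-*ˡ []       a f = sym (zeroʳ a)
  ∑-*ˡ (x ∷ xs) a f = trans (+-congˡ (∑-*ˡ xs a f)) (sym (distribˡ _ _ _))

  ∑-*ʳ : ∀ {A : Set} (xs : List A) (a : Carrier) (f : A → Carrier) → ∑ xs (λ x → f x * a) ≈ ∑ xs f * a
  ∑-*ʳ xs a f = trans (∑-cong xs (λ x → *-comm (f x) a)) (trans (∑-*ˡ xs a f) (*-comm _ _))

  ∑-neg : ∀ {A : Set} (xs : List A) (f : A → Carrier) → ∑ xs (λ x → - f x) ≈ - ∑ xs f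
  ∑-neg []       f = sym -0#≈0#
  ∑-neg (x ∷ xs) f = trans (+-congˡ (∑-neg xs f)) (solve 2 (λ a b → (:- a) :+ (:- b) := :- (a :+ b)) refl _ _)

  ∑-zero : ∀ {A : Set} (xs : List A) (f : A → Carrier) → (∀ x → f x ≈ 0#) → ∑ xs f ≈ 0#
  ∑-zero []       f f≈0 = refl
  ∑-zero (x ∷ xs) f f≈0 = trans (+-cong (f≈0 x) (∑-zero xs f f≈0)) (+-identityˡ 0#)

  ∑-map : ∀ {A B : Set} (xs : List A) (g : A → B) (f : B → Carrier) → ∑ (List.map g xs) f ≈ ∑ xs (λ x → f (g x))
  ∑-map []       g f = refl
  ∑-map (x ∷ xs) g f = +-congˡ (∑-map xs g f)

  ∑-concatMap : ∀ {A B : Set} (xs : List A) (g : A → List B) (f : B → Carrier) →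
                ∑ (List.concatMap g xs) f ≈ ∑ xs (λ x → ∑ (g x) f)
  ∑-concatMap []       g f = refl
  ∑-concatMap (x ∷ xs) g f = trans (∑-++ (g x) (List.concatMap g xs) f) (+-congˡ (∑-concatMap xs g f))

  ∑-swap : ∀ {A B : Set} (xs : List A) (ys : List B) (f : A → B → Carrier) →
           ∑ xs (λ x → ∑ ys (f x)) ≈ ∑ ys (λ y → ∑ xs (λ x → f x y))
  ∑-swap []       ys f = sym (∑-zero ys _ (λ _ → refl))
  ∑-swap (x ∷ xs) ys f = trans (+-congˡ (∑-swap xs ys f)) (sym (∑-+ ys (f x) _))

  ∑-tabulate-zero : ∀ {A : Set} {m} (g : Fin m → A) (f : A → Carrier) →
                    (∀ k → f (g k) ≈ 0#) → ∑ (List.tabulate g) f ≈ 0#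
  ∑-tabulate-zero {m = zero}  g f f≈0 = refl
  ∑-tabulate-zero {m = suc m} g f f≈0 =
    trans (+-cong (f≈0 Fin.zero) (∑-tabulate-zero (λ k → g (Fin.suc k)) f (λ k → f≈0 (Fin.suc k)))) (+-identityˡ 0#)

  ∑-tabulate-single : ∀ {A : Set} {m} (g : Fin m → A) (f : A → Carrier) (i : Fin m) →
                      (∀ k → ¬ k ≡ i → f (g k) ≈ 0#) → ∑ (List.tabulate g) f ≈ f (g i)
  ∑-tabulate-single {m = suc m} g f Fin.zero f≈0 =
    trans (+-congˡ (∑-tabulate-zero (λ k → g (Fin.suc k)) f (λ k → f≈0 (Fin.suc k) (λ ())))) (+-identityʳ _)
  ∑-tabulate-single {m = suc m} g f (Fin.suc i) f≈0 =
    trans (+-cong (f≈0 Fin.zero (λ ()))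
                  (∑-tabulate-single (λ k → g (Fin.suc k)) f i
                     (λ k k≢i → f≈0 (Fin.suc k) (λ k≡i → k≢i (FinP.suc-injective k≡i)))))
          (+-identityˡ _)

  ∑-tabulate-const : ∀ {A : Set} {m} (g : Fin m → A) (a : Carrier) → ∑ (List.tabulate g) (λ _ → a) ≈ m ×1 * a
  ∑-tabulate-const {m = zero}  g a = sym (zeroˡ a)
  ∑-tabulate-const {m = suc m} g a =
    trans (+-congˡ (∑-tabulate-const (λ k → g (Fin.suc k)) a))
          (trans (+-congʳ (sym (*-identityˡ a))) (sym (distribʳ _ _ _)))

  Σ<-cong : ∀ n {f g : ℕ → Carrier} → (∀ i → i < n → f i ≈ g i) → Σ< n f ≈ Σ< n g
  Σ<-cong zero    f≈g = refl
  Σ<-cong (suc n) f≈g = +-cong (Σ<-cong n (λ i i<n → f≈g i (ℕP.m<n⇒m<1+n i<n))) (f≈g n ℕP.≤-refl)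

  Σ<-+ : ∀ n (f g : ℕ → Carrier) → Σ< n (λ i → f i + g i) ≈ Σ< n f + Σ< n g
  Σ<-+ zero    f g = sym (+-identityˡ _)
  Σ<-+ (suc n) f g = trans (+-congʳ (Σ<-+ n f g))
    (solve 4 (λ a b c d → (a :+ b) :+ (c :+ d) := (a :+ c) :+ (b :+ d)) refl _ _ _ _)

  Σ<-*ˡ : ∀ n (a : Carrier) (f : ℕ → Carrier) → Σ< n (λ i → a * f i) ≈ a * Σ< n f
  Σ<-*ˡ zero    a f = sym (zeroʳ a)
  Σ<-*ˡ (suc n) a f = trans (+-congʳ (Σ<-*ˡ n a f)) (sym (distribˡ _ _ _))

  Σ<-zero : ∀ n (f : ℕ → Carrier) → (∀ i → i < n → f i ≈ 0#) → Σ< n f ≈ 0#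
  Σ<-zero zero    f f≈0 = refl
  Σ<-zero (suc n) f f≈0 =
    trans (+-cong (Σ<-zero n f (λ i i<n → f≈0 i (ℕP.m<n⇒m<1+n i<n))) (f≈0 n ℕP.≤-refl)) (+-identityˡ 0#)

  Σ<-neg : ∀ n (f : ℕ → Carrier) → Σ< n (λ i → - f i) ≈ - Σ< n f
  Σ<-neg zero    f = sym -0#≈0#
  Σ<-neg (suc n) f = trans (+-congʳ (Σ<-neg n f)) (solve 2 (λ a b → (:- a) :+ (:- b) := :- (a :+ b)) refl _ _)

  Σ<-suc : ∀ m (f : ℕ → Carrier) → Σ< (suc m) f ≈ f 0 + Σ< m (λ k → f (suc k))
  Σ<-suc zero    f = trans (+-identityˡ _) (sym (+-identityʳ _))
  Σ<-suc (suc m) f = trans (+-congʳ (Σ<-suc m f)) (+-assoc _ _ _)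

  Σ<-reverse : ∀ m (f : ℕ → Carrier) → Σ< m f ≈ Σ< m (λ k → f (m ℕ.∸ suc k))
  Σ<-reverse zero    f = refl
  Σ<-reverse (suc m) f = begin
    Σ< m f + f m                          ≈⟨ +-congʳ (Σ<-reverse m f) ⟩
    Σ< m (λ k → f (m ℕ.∸ suc k)) + f m    ≈⟨ +-comm _ _ ⟩
    f m + Σ< m (λ k → f (m ℕ.∸ suc k))    ≈⟨ sym (Σ<-suc m _) ⟩
    Σ< (suc m) (λ k → f (suc m ℕ.∸ suc k)) ∎

  ∑-Σ<-swap : ∀ {A : Set} (xs : List A) n (f : A → ℕ → Carrier) →
              ∑ xs (λ x → Σ< n (f x)) ≈ Σ< n (λ i → ∑ xs (λ x → f x i))
  ∑-Σ<-swap xs zero    f = ∑-zero xs _ (λ _ → refl)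
  ∑-Σ<-swap xs (suc n) f = trans (∑-+ xs _ _) (+-congʳ (∑-Σ<-swap xs n f))

  ∑-applyUpTo : ∀ {A : Set} m (h : ℕ → A) (f : A → Carrier) → ∑ (List.applyUpTo h m) f ≈ Σ< m (λ i → f (h i))
  ∑-applyUpTo zero    h f = refl
  ∑-applyUpTo (suc m) h f = trans (+-congˡ (∑-applyUpTo m (λ i → h (suc i)) f)) (sym (Σ<-suc m (λ i → f (h i))))

  ∑-splits : ∀ m (φ : ℕ × ℕ → Carrier) → ∑ (splits (suc m)) φ ≈ Σ< m (λ k → φ (suc m ℕ.∸ suc k , suc k))
  ∑-splits m φ = begin
    ∑ (splits (suc m)) φ
      ≈⟨ ∑-map (List.upTo m) _ φ ⟩
    ∑ (List.upTo m) (λ i → φ (suc i , suc m ℕ.∸ suc i))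
      ≈⟨ ∑-applyUpTo m (λ i → i) _ ⟩
    Σ< m (λ i → φ (suc i , suc m ℕ.∸ suc i))
      ≈⟨ Σ<-reverse m _ ⟩
    Σ< m (λ k → φ (suc (m ℕ.∸ suc k) , m ℕ.∸ (m ℕ.∸ suc k)))
      ≈⟨ Σ<-cong m (λ k k<m → ≈-reflexive (Eq.cong φ
           (Eq.cong₂ _,_ (Eq.sym (ℕP.+-∸-assoc 1 k<m)) (ℕP.m∸[m∸n]≡n k<m)))) ⟩
    Σ< m (λ k → φ (suc m ℕ.∸ suc k , suc k)) ∎

  ∑-cong-All : ∀ {A : Set} {P : A → Set} {xs : List A} {f g : A → Carrier} →
               All P xs → (∀ x → P x → f x ≈ g x) → ∑ xs f ≈ ∑ xs g
  ∑-cong-All All.[]         f≈g = refl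
  ∑-cong-All (px All.∷ pxs) f≈g = +-cong (f≈g _ px) (∑-cong-All pxs f≈g)

  ∣⇒×1≈0 : ∀ {p m} → p ×1 ≈ 0# → p ∣ m → m ×1 ≈ 0#
  ∣⇒×1≈0 {p} p≈0 (divides q Eq.refl) = trans (×1-* q p) (trans (*-congˡ p≈0) (zeroʳ _))

  module _ {q : ℕ} (p-prime : Prime (2+ q)) (char-p : 2+ q ×1 ≈ 0#) where

    private
      p = 2+ q

    frobenius : ∀ x y → (x + y) ↑ p ≈ x ↑ p + y ↑ p
    frobenius x y = begin
      (x + y) ↑ p      ≈⟨ sym (^≈↑ (x + y) p) ⟩
      (x + y) ^ᴷ p     ≈⟨ Binomial.theorem p x y ⟩
      sum t            ≈⟨ +-congˡ (sum-init-last (λ k → t (Fin.suc k))) ⟩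
      t Fin.zero + (sum (λ k → t (Fin.suc (Fin.inject₁ k))) + t (Fin.suc (Fin.fromℕ (suc q))))
                       ≈⟨ +-congˡ (+-congʳ (trans (sum-cong-≋ middle-vanishes) (sum-replicate-zero (suc q)))) ⟩
      t Fin.zero + (0# + t (Fin.suc (Fin.fromℕ (suc q))))
                       ≈⟨ +-cong first (trans (+-identityˡ _) last) ⟩
      y ↑ p + x ↑ p    ≈⟨ +-comm _ _ ⟩
      x ↑ p + y ↑ p    ∎
      where
      t = Binomial.binomialTerm x y p
      ^≈↑ : ∀ x n → x ^ᴷ n ≈ x ↑ n
      ^≈↑ x zero    = refl
      ^≈↑ x (suc n) = *-congˡ (^≈↑ x n)
      ×≈×1* : ∀ n x → n ×ᴷ x ≈ n ×1 * x
      ×≈×1* zero    x = sym (zeroˡ x)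
      ×≈×1* (suc n) x = trans (+-cong (sym (*-identityˡ x)) (×≈×1* n x)) (sym (distribʳ _ _ _))
      first : t Fin.zero ≈ y ↑ p
      first = trans (+-identityʳ _) (trans (*-identityˡ _) (^≈↑ y p))
      last : t (Fin.suc (Fin.fromℕ (suc q))) ≈ x ↑ p
      last = begin
        (p C toℕ (Fin.fromℕ p)) ×ᴷ (x ^ᴷ toℕ (Fin.fromℕ p) * y ^ᴷ (p ℕ.∸ toℕ (Fin.fromℕ p)))
          ≈⟨ ≈-reflexive (Eq.cong (λ k → (p C k) ×ᴷ (x ^ᴷ k * y ^ᴷ (p ℕ.∸ k))) (FinP.toℕ-fromℕ p)) ⟩
        (p C p) ×ᴷ (x ^ᴷ p * y ^ᴷ (p ℕ.∸ p))
          ≈⟨ ≈-reflexive (Eq.cong (λ k → k ×ᴷ (x ^ᴷ p * y ^ᴷ (p ℕ.∸ p))) (nCn≡1 p)) ⟩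
        1 ×ᴷ (x ^ᴷ p * y ^ᴷ (p ℕ.∸ p))
          ≈⟨ +-identityʳ _ ⟩
        x ^ᴷ p * y ^ᴷ (p ℕ.∸ p)
          ≈⟨ *-cong (^≈↑ x p) (≈-reflexive (Eq.cong (y ^ᴷ_) (ℕP.n∸n≡0 p))) ⟩
        x ↑ p * 1#
          ≈⟨ *-identityʳ _ ⟩
        x ↑ p ∎
      middle-vanishes : ∀ k → t (Fin.suc (Fin.inject₁ k)) ≈ 0#
      middle-vanishes k = trans (×≈×1* (p C suc (toℕ (Fin.inject₁ k))) _)
        (trans (*-congʳ (∣⇒×1≈0 char-p (prime∣pCk p-prime (suc (toℕ (Fin.inject₁ k))) (ℕ.s≤s ℕ.z≤n) k+1<p))) (zeroˡ _))
        where
        k+1<p : suc (toℕ (Fin.inject₁ k)) < p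
        k+1<p = ℕ.s≤s (Eq.subst (_< suc q) (Eq.sym (FinP.toℕ-inject₁ k)) (FinP.toℕ<n k))

    frobenius-↑^ : ∀ n x y → (x + y) ↑ (p ^ n) ≈ x ↑ (p ^ n) + y ↑ (p ^ n)
    frobenius-↑^ zero    x y = trans (*-identityʳ _) (sym (+-cong (*-identityʳ _) (*-identityʳ _)))
    frobenius-↑^ (suc n) x y = begin
      (x + y) ↑ (p ℕ.* p ^ n)               ≈⟨ ↑-* (x + y) p (p ^ n) ⟩
      ((x + y) ↑ p) ↑ (p ^ n)               ≈⟨ ↑-cong (p ^ n) (frobenius x y) ⟩
      (x ↑ p + y ↑ p) ↑ (p ^ n)             ≈⟨ frobenius-↑^ n (x ↑ p) (y ↑ p) ⟩
      (x ↑ p) ↑ (p ^ n) + (y ↑ p) ↑ (p ^ n) ≈⟨ sym (+-cong (↑-* x p (p ^ n)) (↑-* y p (p ^ n))) ⟩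
      x ↑ (p ℕ.* p ^ n) + y ↑ (p ℕ.* p ^ n) ∎

  -- Polynomial functions

  horner : ∀ {n} → Vec Carrier n → Carrier → Carrier
  horner []       z = 0#
  horner (a ∷ as) z = a + z * horner as z

  PolyFun : ℕ → (Carrier → Carrier) → Set (c ⊔ ℓ)
  PolyFun n f = Σ (Vec Carrier (suc n)) (λ as → ∀ z → f z ≈ horner as z)

  horner-divide : ∀ {n} (as : Vec Carrier (suc n)) a →
                  Σ (Vec Carrier n) (λ qs → ∀ z → horner as z ≈ horner as a + (z - a) * horner qs z)
  horner-divide (b ∷ []) a = [] , λ z →
    solve 3 (λ b z a → b :+ z :* con (+ 0) := (b :+ a :* con (+ 0)) :+ (z :- a) :* con (+ 0)) refl b z a
  horner-divide (b ∷ as@(_ ∷ _)) a with horner-divide as a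
  ... | qs , as≈ = (horner as a ∷ qs) , λ z → begin
    b + z * horner as z                                    ≈⟨ +-congˡ (*-congˡ (as≈ z)) ⟩
    b + z * (horner as a + (z - a) * horner qs z)          ≈⟨ solve 5 (λ b z a g q → b :+ z :* (g :+ (z :- a) :* q)
                                                                := (b :+ a :* g) :+ (z :- a) :* (g :+ z :* q))
                                                                refl b z a (horner as a) (horner qs z) ⟩
    (b + a * horner as a) + (z - a) * (horner as a + z * horner qs z) ∎

  horner-vanishes : ∀ n (as : Vec Carrier (suc n)) (pts : Fin (suc n) → Carrier) →
                    (∀ i j → pts i ≈ pts j → i ≡ j) → (∀ i → horner as (pts i) ≈ 0#) → ∀ z → horner as z ≈ 0#
  horner-vanishes zero (b ∷ []) pts _ as≈0 z =
    trans (+-congˡ (zeroʳ z)) (trans (sym (+-congˡ (zeroʳ (pts Fin.zero)))) (as≈0 Fin.zero))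
  horner-vanishes (suc n) as pts pts-injective as≈0 z with horner-divide as (pts Fin.zero)
  ... | qs , as≈ = begin
    horner as z                          ≈⟨ as≈ z ⟩
    horner as a + (z - a) * horner qs z  ≈⟨ +-cong (as≈0 Fin.zero) (*-congˡ (horner-vanishes n qs (λ i → pts (Fin.suc i))
                                              (λ i j eq → FinP.suc-injective (pts-injective _ _ eq)) qs≈0 z)) ⟩
    0# + (z - a) * 0#                    ≈⟨ trans (+-identityˡ _) (zeroʳ _) ⟩
    0#                                   ∎
    where
    a = pts Fin.zero
    qs≈0 : ∀ i → horner qs (pts (Fin.suc i)) ≈ 0#
    qs≈0 i = *-cancelˡ-zero pᵢ-a≉0 (begin
      (pts (Fin.suc i) - a) * horner qs (pts (Fin.suc i))                ≈⟨ sym (+-identityˡ _) ⟩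
      0# + (pts (Fin.suc i) - a) * horner qs (pts (Fin.suc i))           ≈⟨ +-congʳ (sym (as≈0 Fin.zero)) ⟩
      horner as a + (pts (Fin.suc i) - a) * horner qs (pts (Fin.suc i))  ≈⟨ sym (as≈ _) ⟩
      horner as (pts (Fin.suc i))                                        ≈⟨ as≈0 (Fin.suc i) ⟩
      0#                                                                 ∎)
      where
      pᵢ-a≉0 : Nonzero (pts (Fin.suc i) - a)
      pᵢ-a≉0 eq with pts-injective _ _ (x-y≈0⇒x≈y eq)
      ... | ()

  PolyFun-vanishes : ∀ {n f} → PolyFun n f → (pts : Fin (suc n) → Carrier) →
                     (∀ i j → pts i ≈ pts j → i ≡ j) → (∀ i → f (pts i) ≈ 0#) → ∀ z → f z ≈ 0#
  PolyFun-vanishes {n} (as , f≈) pts pts-injective f≈0 z =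
    trans (f≈ z) (horner-vanishes n as pts pts-injective (λ i → trans (sym (f≈ (pts i))) (f≈0 i)) z)

  horner-replicate-0 : ∀ n z → horner (Vec.replicate n 0#) z ≈ 0#
  horner-replicate-0 zero    z = refl
  horner-replicate-0 (suc n) z = trans (+-congˡ (trans (*-congˡ (horner-replicate-0 n z)) (zeroʳ z))) (+-identityˡ 0#)

  PolyFun-cong : ∀ {n f g} → (∀ z → f z ≈ g z) → PolyFun n f → PolyFun n g
  PolyFun-cong f≈g (as , f≈) = as , λ z → trans (sym (f≈g z)) (f≈ z)

  PolyFun-const : ∀ n a → PolyFun n (λ _ → a)
  PolyFun-const n a = (a ∷ Vec.replicate n 0#) , λ z →
    sym (trans (+-congˡ (trans (*-congˡ (horner-replicate-0 n z)) (zeroʳ z))) (+-identityʳ a))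

  horner-+ : ∀ {n} (as bs : Vec Carrier n) z → horner (Vec.zipWith _+_ as bs) z ≈ horner as z + horner bs z
  horner-+ []       []       z = sym (+-identityˡ 0#)
  horner-+ (a ∷ as) (b ∷ bs) z = trans (+-congˡ (*-congˡ (horner-+ as bs z)))
    (solve 5 (λ a b z x y → a :+ b :+ z :* (x :+ y) := (a :+ z :* x) :+ (b :+ z :* y)) refl a b z _ _)

  PolyFun-+ : ∀ {n f g} → PolyFun n f → PolyFun n g → PolyFun n (λ z → f z + g z)
  PolyFun-+ (as , f≈) (bs , g≈) = Vec.zipWith _+_ as bs , λ z → trans (+-cong (f≈ z) (g≈ z)) (sym (horner-+ as bs z))

  horner-scale : ∀ {n} a (as : Vec Carrier n) z → horner (Vec.map (a *_) as) z ≈ a * horner as z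
  horner-scale a []       z = sym (zeroʳ a)
  horner-scale a (b ∷ as) z = trans (+-congˡ (*-congˡ (horner-scale a as z)))
    (solve 4 (λ a b z x → a :* b :+ z :* (a :* x) := a :* (b :+ z :* x)) refl a b z _)

  PolyFun-scale : ∀ {n f} a → PolyFun n f → PolyFun n (λ z → a * f z)
  PolyFun-scale a (as , f≈) = Vec.map (a *_) as , λ z → trans (*-congˡ (f≈ z)) (sym (horner-scale a as z))

  PolyFun-mulX : ∀ {n f} → PolyFun n f → PolyFun (suc n) (λ z → z * f z)
  PolyFun-mulX (as , f≈) = (0# ∷ as) , λ z → trans (*-congˡ (f≈ z)) (sym (+-identityˡ _))

  horner-∷ʳ-0 : ∀ {n} (as : Vec Carrier n) z → horner (as Vec.∷ʳ 0#) z ≈ horner as z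
  horner-∷ʳ-0 []       z = trans (+-congˡ (zeroʳ z)) (+-identityˡ 0#)
  horner-∷ʳ-0 (a ∷ as) z = +-congˡ (*-congˡ (horner-∷ʳ-0 as z))

  PolyFun-weaken : ∀ {n f} → PolyFun n f → PolyFun (suc n) f
  PolyFun-weaken (as , f≈) = (as Vec.∷ʳ 0#) , λ z → trans (f≈ z) (sym (horner-∷ʳ-0 as z))

  PolyFun-weaken≤ : ∀ {m n f} → m ≤ n → PolyFun m f → PolyFun n f
  PolyFun-weaken≤ {m} {f = f} m≤n pf with ℕP.m≤n⇒∃[o]m+o≡n m≤n
  ... | o , Eq.refl = weaken-by o pf
    where
    weaken-by : ∀ {m} o → PolyFun m f → PolyFun (m ℕ.+ o) f
    weaken-by {m} zero    pf = Eq.subst (λ k → PolyFun k f) (Eq.sym (ℕP.+-identityʳ m)) pf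
    weaken-by {m} (suc o) pf = Eq.subst (λ k → PolyFun k f) (Eq.sym (ℕP.+-suc m o)) (PolyFun-weaken (weaken-by o pf))

  PolyFun-pow : ∀ m a → PolyFun m (λ z → (z - a) ↑ m)
  PolyFun-pow zero    a = PolyFun-const 0 1#
  PolyFun-pow (suc m) a = PolyFun-cong (λ z → solve 3 (λ z a y → z :* y :+ (:- a) :* y := (z :- a) :* y) refl z a _)
    (PolyFun-+ (PolyFun-mulX (PolyFun-pow m a)) (PolyFun-weaken (PolyFun-scale (- a) (PolyFun-pow m a))))

  PolyFun-∑ : ∀ {A : Set} {n} (xs : List A) (f : A → Carrier → Carrier) →
              (∀ x → PolyFun n (f x)) → PolyFun n (λ z → ∑ xs (λ x → f x z))
  PolyFun-∑ {n = n} []       f pf = PolyFun-const n 0#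
  PolyFun-∑         (x ∷ xs) f pf = PolyFun-+ (pf x) (PolyFun-∑ xs f pf)

  -- Partial fractions

  binom : ℕ → ℕ → ℕ
  binom zero    zero    = 1
  binom (suc s) zero    = 0
  binom zero    (suc j) = 0
  binom (suc s) (suc j) = binom (suc s) j ℕ.+ binom s j

  binom-suc-suc : ∀ s j → binom (suc s) (suc j) ≡ j C s
  binom-suc-suc zero    zero    = Eq.refl
  binom-suc-suc (suc s) zero    = Eq.refl
  binom-suc-suc zero    (suc j) = Eq.cong (ℕ._+ 0) (binom-suc-suc zero j)
  binom-suc-suc (suc s) (suc j) = Eq.trans (Eq.cong₂ ℕ._+_ (binom-suc-suc (suc s) j) (binom-suc-suc s j))
    (Eq.trans (ℕP.+-comm (j C suc s) (j C s)) (nCk+nC[k+1]≡[n+1]C[k+1] j s))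

  binom-below : ∀ s j → j < s → binom s j ≡ 0
  binom-below (suc s) zero    _           = Eq.refl
  binom-below (suc s) (suc j) (ℕ.s≤s j<s) =
    Eq.cong₂ ℕ._+_ (binom-below (suc s) j (ℕP.m<n⇒m<1+n j<s)) (binom-below s j j<s)

  sign : ℕ → Carrier
  sign k = (- 1#) ↑ k

  sign-suc : ∀ k → sign (suc k) ≈ - sign k
  sign-suc k = solve 1 (λ a → (:- con (+ 1)) :* a := :- a) refl (sign k)

  sign-+ : ∀ m k → sign (m ℕ.+ k) ≈ sign m * sign k
  sign-+ m k = ↑-+ (- 1#) m k

  ℤ→K-sgn : ∀ m → ℤ→K (sgn m) ≈ sign m
  ℤ→K-sgn zero          = +-identityʳ 1#
  ℤ→K-sgn (suc zero)    = trans (-‿cong (+-identityʳ 1#)) (sym (*-identityʳ _))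
  ℤ→K-sgn (suc (suc m)) = trans (ℤ→K-sgn m) (solve 1 (λ a → a := (:- con (+ 1)) :* ((:- con (+ 1)) :* a)) refl (sign m))

  -- With x = X⁻¹, y = Y⁻¹ and c = (Y - X)⁻¹ this is the partial fraction
  -- expansion of X^{-s₁} Y^{-s₂}, with binom s j = C(j - 1, s - 1).
  module PartialFractions (x y c : Carrier) where

    partialFractionSum : ℕ → ℕ → ℕ → Carrier
    partialFractionSum n s₁ s₂ = Σ< n (λ j → c ↑ j * ( sign (j ℕ.+ s₂) * binom s₂ j ×1 * x ↑ (n ℕ.∸ j)
                                                     + sign s₁ * binom s₁ j ×1 * y ↑ (n ℕ.∸ j)))

    partialFractionSum-step : ∀ n s₁ s₂ →
      c * (partialFractionSum n (suc s₁) s₂ - partialFractionSum n s₁ (suc s₂))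
        ≈ partialFractionSum (suc n) (suc s₁) (suc s₂)
    partialFractionSum-step n s₁ s₂ = begin
      c * (partialFractionSum n (suc s₁) s₂ - partialFractionSum n s₁ (suc s₂))
        ≈⟨ *-congˡ (+-congˡ (sym (Σ<-neg n _))) ⟩
      c * (partialFractionSum n (suc s₁) s₂ + Σ< n (λ j → - term s₁ (suc s₂) j))
        ≈⟨ trans (*-congˡ (sym (Σ<-+ n _ _))) (sym (Σ<-*ˡ n c _)) ⟩
      Σ< n (λ j → c * (term (suc s₁) s₂ j + - term s₁ (suc s₂) j))
        ≈⟨ Σ<-cong n (λ j _ → term-step j) ⟩
      Σ< n (λ j → T (suc j))
        ≈⟨ sym (trans (Σ<-suc n T) (trans (+-congʳ T0≈0) (+-identityˡ _))) ⟩
      partialFractionSum (suc n) (suc s₁) (suc s₂) ∎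
      where
      term : ℕ → ℕ → ℕ → Carrier
      term s₁ s₂ j = c ↑ j * (sign (j ℕ.+ s₂) * binom s₂ j ×1 * x ↑ (n ℕ.∸ j) + sign s₁ * binom s₁ j ×1 * y ↑ (n ℕ.∸ j))
      T : ℕ → Carrier
      T j = c ↑ j * ( sign (j ℕ.+ suc s₂) * binom (suc s₂) j ×1 * x ↑ (suc n ℕ.∸ j)
                    + sign (suc s₁) * binom (suc s₁) j ×1 * y ↑ (suc n ℕ.∸ j))
      T0≈0 : T 0 ≈ 0#
      T0≈0 = trans (*-congˡ (+-cong (trans (*-congʳ (zeroʳ _)) (zeroˡ _)) (trans (*-congʳ (zeroʳ _)) (zeroˡ _))))
                   (trans (*-congˡ (+-identityˡ 0#)) (zeroʳ _))
      term-step : ∀ j → c * (term (suc s₁) s₂ j + - term s₁ (suc s₂) j) ≈ T (suc j)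
      term-step j = begin
        c * (term (suc s₁) s₂ j + - term s₁ (suc s₂) j)
          ≈⟨ *-congˡ (+-cong (*-congˡ (+-cong (*-congʳ (*-congʳ (sign-+ j s₂))) (*-congʳ (*-congʳ (sign-suc s₁)))))
                             (-‿cong (*-congˡ (+-congʳ (*-congʳ (*-congʳ (trans (sign-+ j (suc s₂)) (*-congˡ (sign-suc s₂))))))))) ⟩
        c * (c ↑ j * (sign j * sign s₂ * A₀ * X + - sign s₁ * B₁ * Y) + - (c ↑ j * (sign j * - sign s₂ * A₁ * X + sign s₁ * B₀ * Y)))
          ≈⟨ solve 11 (λ c cj sj s2 s1 a0 a1 b0 b1 X Y →
                c :* (cj :* (sj :* s2 :* a0 :* X :+ :- s1 :* b1 :* Y) :+ :- (cj :* (sj :* :- s2 :* a1 :* X :+ s1 :* b0 :* Y)))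
                := (c :* cj) :* ((sj :* s2) :* (a1 :+ a0) :* X :+ :- s1 :* (b1 :+ b0) :* Y))
              refl c (c ↑ j) (sign j) (sign s₂) (sign s₁) A₀ A₁ B₀ B₁ X Y ⟩
        (c * c ↑ j) * ((sign j * sign s₂) * (A₁ + A₀) * X + - sign s₁ * (B₁ + B₀) * Y)
          ≈⟨ *-congˡ (+-cong (*-congʳ (*-cong (sym sign-eq) (sym (×1-+ (binom (suc s₂) j) (binom s₂ j)))))
                             (*-congʳ (*-cong (sym (sign-suc s₁)) (sym (×1-+ (binom (suc s₁) j) (binom s₁ j)))))) ⟩
        T (suc j) ∎
        where
        A₀ = binom s₂ j ×1
        A₁ = binom (suc s₂) j ×1
        B₀ = binom s₁ j ×1
        B₁ = binom (suc s₁) j ×1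
        X = x ↑ (n ℕ.∸ j)
        Y = y ↑ (n ℕ.∸ j)
        sign-eq : sign (suc j ℕ.+ suc s₂) ≈ sign j * sign s₂
        sign-eq = begin
          sign (suc (j ℕ.+ suc s₂)) ≈⟨ sign-suc (j ℕ.+ suc s₂) ⟩
          - sign (j ℕ.+ suc s₂)     ≈⟨ -‿cong (trans (sign-+ j (suc s₂)) (*-congˡ (sign-suc s₂))) ⟩
          - (sign j * - sign s₂)    ≈⟨ solve 2 (λ a b → :- (a :* :- b) := a :* b) refl (sign j) (sign s₂) ⟩
          sign j * sign s₂          ∎

    partialFractionSum-x : ∀ m → partialFractionSum (suc m) (suc m) 0 ≈ x ↑ suc m
    partialFractionSum-x m = begin
      partialFractionSum (suc m) (suc m) 0 ≈⟨ Σ<-suc m _ ⟩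
      _                                    ≈⟨ +-cong first (Σ<-zero m _ rest≈0) ⟩
      x ↑ suc m + 0#                       ≈⟨ +-identityʳ _ ⟩
      x ↑ suc m                            ∎
      where
      first = trans (*-identityˡ _) (trans (+-cong (trans (*-congʳ (trans (*-identityˡ _) (+-identityʳ _))) (*-identityˡ _))
                                                   (trans (*-congʳ (zeroʳ _)) (zeroˡ _)))
                                           (+-identityʳ _))
      rest≈0 = λ k k<m → trans (*-congˡ (+-cong (trans (*-congʳ (zeroʳ _)) (zeroˡ _))
        (trans (*-congʳ (trans (*-congˡ (≈-reflexive (Eq.cong _×1 (binom-below (suc m) (suc k) (ℕ.s≤s k<m))))) (zeroʳ _))) (zeroˡ _))))
        (trans (*-congˡ (+-identityˡ 0#)) (zeroʳ _))

    partialFractionSum-y : ∀ m → partialFractionSum (suc m) 0 (suc m) ≈ y ↑ suc m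
    partialFractionSum-y m = begin
      partialFractionSum (suc m) 0 (suc m) ≈⟨ Σ<-suc m _ ⟩
      _                                    ≈⟨ +-cong first (Σ<-zero m _ rest≈0) ⟩
      y ↑ suc m + 0#                       ≈⟨ +-identityʳ _ ⟩
      y ↑ suc m                            ∎
      where
      first = trans (*-identityˡ _) (trans (+-cong (trans (*-congʳ (zeroʳ _)) (zeroˡ _))
                                                   (trans (*-congʳ (trans (*-identityˡ _) (+-identityʳ _))) (*-identityˡ _)))
                                           (+-identityˡ _))
      rest≈0 = λ k k<m → trans (*-congˡ (+-cong
        (trans (*-congʳ (trans (*-congˡ (≈-reflexive (Eq.cong _×1 (binom-below (suc m) (suc k) (ℕ.s≤s k<m))))) (zeroʳ _))) (zeroˡ _))
        (trans (*-congʳ (zeroʳ _)) (zeroˡ _))))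
        (trans (*-congˡ (+-identityˡ 0#)) (zeroʳ _))

    partial-fractions : x * y ≈ c * (x - y) → ∀ s₁ s₂ → 1 ≤ s₁ ℕ.+ s₂ →
                        x ↑ s₁ * y ↑ s₂ ≈ partialFractionSum (s₁ ℕ.+ s₂) s₁ s₂
    partial-fractions xy≈c[x-y] zero (suc s₂) _ = trans (*-identityˡ _) (sym (partialFractionSum-y s₂))
    partial-fractions xy≈c[x-y] (suc s₁) zero _ =
      trans (*-identityʳ _) (sym (trans (≈-reflexive (Eq.cong (λ n → partialFractionSum n (suc s₁) 0) (ℕP.+-identityʳ (suc s₁))))
                                        (partialFractionSum-x s₁)))
    partial-fractions xy≈c[x-y] (suc s₁) (suc s₂) _ = begin
      (x * x ↑ s₁) * (y * y ↑ s₂)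
        ≈⟨ solve 4 (λ x y a b → (x :* a) :* (y :* b) := (x :* y) :* (a :* b)) refl x y (x ↑ s₁) (y ↑ s₂) ⟩
      (x * y) * (x ↑ s₁ * y ↑ s₂)
        ≈⟨ *-congʳ xy≈c[x-y] ⟩
      (c * (x - y)) * (x ↑ s₁ * y ↑ s₂)
        ≈⟨ solve 5 (λ c x y a b → (c :* (x :- y)) :* (a :* b) := c :* ((x :* a) :* b :- a :* (y :* b))) refl c x y (x ↑ s₁) (y ↑ s₂) ⟩
      c * (x ↑ suc s₁ * y ↑ s₂ - x ↑ s₁ * y ↑ suc s₂)
        ≈⟨ *-congˡ (+-cong (partial-fractions xy≈c[x-y] (suc s₁) s₂ (ℕ.s≤s ℕ.z≤n))
                           (-‿cong (trans (partial-fractions xy≈c[x-y] s₁ (suc s₂) (ℕP.≤-trans (ℕ.s≤s ℕ.z≤n) (ℕP.m≤n+m (suc s₂) s₁)))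
                                          (≈-reflexive (Eq.cong (λ n → partialFractionSum n s₁ (suc s₂)) (ℕP.+-suc s₁ s₂)))))) ⟩
      c * (partialFractionSum (suc (s₁ ℕ.+ s₂)) (suc s₁) s₂ - partialFractionSum (suc (s₁ ℕ.+ s₂)) s₁ (suc s₂))
        ≈⟨ partialFractionSum-step (suc (s₁ ℕ.+ s₂)) s₁ s₂ ⟩
      partialFractionSum (suc (suc (s₁ ℕ.+ s₂))) (suc s₁) (suc s₂)
        ≈⟨ ≈-reflexive (Eq.cong (λ n → partialFractionSum n (suc s₁) (suc s₂)) (Eq.cong suc (Eq.sym (ℕP.+-suc s₁ s₂)))) ⟩
      partialFractionSum (suc s₁ ℕ.+ suc s₂) (suc s₁) (suc s₂) ∎

  ⁻¹*⁻¹≈partial-fraction : ∀ {X Y} → Nonzero X → Nonzero Y → Nonzero (Y - X) →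
                           X ⁻¹ * Y ⁻¹ ≈ (Y - X) ⁻¹ * (X ⁻¹ - Y ⁻¹)
  ⁻¹*⁻¹≈partial-fraction {X} {Y} X≉0 Y≉0 Y-X≉0 = sym (begin
    (Y - X) ⁻¹ * (X ⁻¹ - Y ⁻¹)               ≈⟨ *-congˡ (sym (begin
        (Y - X) * (X ⁻¹ * Y ⁻¹)                   ≈⟨ solve 4 (λ X Y Xi Yi → (Y :- X) :* (Xi :* Yi) := (Y :* Yi) :* Xi :- (X :* Xi) :* Yi) refl X Y (X ⁻¹) (Y ⁻¹) ⟩
        (Y * Y ⁻¹) * X ⁻¹ - (X * X ⁻¹) * Y ⁻¹     ≈⟨ +-cong (trans (*-congʳ (⁻¹-inv Y Y≉0)) (*-identityˡ _))
                                                             (-‿cong (trans (*-congʳ (⁻¹-inv X X≉0)) (*-identityˡ _))) ⟩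
        X ⁻¹ - Y ⁻¹                               ∎)) ⟩
    (Y - X) ⁻¹ * ((Y - X) * (X ⁻¹ * Y ⁻¹))   ≈⟨ sym (*-assoc _ _ _) ⟩
    ((Y - X) ⁻¹ * (Y - X)) * (X ⁻¹ * Y ⁻¹)   ≈⟨ trans (*-congʳ (⁻¹-inverseˡ Y-X≉0)) (*-identityˡ _) ⟩
    X ⁻¹ * Y ⁻¹                              ∎)

  module FiniteSubfield (r-2 : ℕ)
    (r≈0 : 2+ r-2 ×1 ≈ 0#)
    (frobenius-r : ∀ x y → (x + y) ↑ 2+ r-2 ≈ x ↑ 2+ r-2 + y ↑ 2+ r-2)
    (F : Fin (2+ r-2) → Carrier)
    (F-injective : ∀ i j → F i ≈ F j → i ≡ j)
    (F-root : ∀ i → F i ↑ 2+ r-2 ≈ F i)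
    where

    -- The subfield 𝔽_r

    r e : ℕ
    r = 2+ r-2
    e = suc r-2

    ∑F : (Fin r → Carrier) → Carrier
    ∑F = ∑ (List.allFin r)

    InFr : Carrier → Set ℓ
    InFr z = z ↑ r ≈ z

    InFr-0 : InFr 0#
    InFr-0 = zeroˡ _

    InFr-1 : InFr 1#
    InFr-1 = 1↑ r

    InFr-* : ∀ {x y} → InFr x → InFr y → InFr (x * y)
    InFr-* {x} {y} x∈Fr y∈Fr = trans (*-↑ x y r) (*-cong x∈Fr y∈Fr)

    InFr-+ : ∀ {x y} → InFr x → InFr y → InFr (x + y)
    InFr-+ {x} {y} x∈Fr y∈Fr = trans (frobenius-r x y) (+-cong x∈Fr y∈Fr)

    InFr-neg : ∀ {x} → InFr x → InFr (- x)
    InFr-neg {x} x∈Fr = trans ↑r-neg (-‿cong x∈Fr)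
      where
      ↑r-neg : (- x) ↑ r ≈ - (x ↑ r)
      ↑r-neg = begin
        (- x) ↑ r                   ≈⟨ solve 2 (λ a b → a := (a :+ b) :- b) refl ((- x) ↑ r) (x ↑ r) ⟩
        ((- x) ↑ r + x ↑ r) - x ↑ r ≈⟨ +-congʳ (sym (frobenius-r (- x) x)) ⟩
        (- x + x) ↑ r - x ↑ r       ≈⟨ +-congʳ (trans (↑-cong r (-‿inverseˡ x)) (zeroˡ _)) ⟩
        0# - x ↑ r                  ≈⟨ +-identityˡ _ ⟩
        - (x ↑ r)                   ∎

    InFr-sub : ∀ {x y} → InFr x → InFr y → InFr (x - y)
    InFr-sub x∈Fr y∈Fr = InFr-+ x∈Fr (InFr-neg y∈Fr)

    InFr-⁻¹ : ∀ {t} → InFr t → Nonzero t → InFr (t ⁻¹)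
    InFr-⁻¹ {t} t∈Fr t≉0 = trans (sym (⁻¹-↑ r t≉0)) (⁻¹-cong t∈Fr)

    InFr-↑e≈1 : ∀ {t} → InFr t → Nonzero t → t ↑ e ≈ 1#
    InFr-↑e≈1 {t} t∈Fr t≉0 = x-y≈0⇒x≈y (*-cancelˡ-zero t≉0 (begin
      t * (t ↑ e - 1#) ≈⟨ solve 2 (λ a b → a :* (b :- con (+ 1)) := a :* b :- a) refl t (t ↑ e) ⟩
      t ↑ r - t        ≈⟨ x≈y⇒x-y≈0 t∈Fr ⟩
      0#               ∎))

    InFr-↑-periodic : ∀ {z} k → InFr z → z ↑ (suc k ℕ.+ e) ≈ z ↑ suc k
    InFr-↑-periodic {z} k z∈Fr = begin
      z ↑ (suc k ℕ.+ e)      ≈⟨ ↑-+ z (suc k) e ⟩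
      z ↑ suc k * z ↑ e      ≈⟨ solve 3 (λ a b c → (a :* b) :* c := b :* (a :* c)) refl z (z ↑ k) (z ↑ e) ⟩
      z ↑ k * (z * z ↑ e)    ≈⟨ *-congˡ z∈Fr ⟩
      z ↑ k * z              ≈⟨ *-comm _ _ ⟩
      z ↑ suc k              ∎

    neg-↑e : ∀ y → (- y) ↑ e ≈ y ↑ e
    neg-↑e y = begin
      (- y) ↑ e          ≈⟨ ↑-cong e (solve 1 (λ y → :- y := (:- con (+ 1)) :* y) refl y) ⟩
      (- 1# * y) ↑ e     ≈⟨ *-↑ _ _ e ⟩
      (- 1#) ↑ e * y ↑ e ≈⟨ *-congʳ (InFr-↑e≈1 (InFr-neg InFr-1) (-‿nonzero 1-nonzero)) ⟩
      1# * y ↑ e         ≈⟨ *-identityˡ _ ⟩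
      y ↑ e              ∎

    F-distinct : ∀ {i j} → ¬ i ≡ j → Nonzero (F i - F j)
    F-distinct i≢j Fi-Fj≈0 = i≢j (F-injective _ _ (x-y≈0⇒x≈y Fi-Fj≈0))

    ∑F-const : ∀ a → ∑F (λ _ → a) ≈ 0#
    ∑F-const a = trans (∑-tabulate-const {m = r} (λ k → k) a) (trans (*-congʳ r≈0) (zeroˡ a))

    -- The polynomial Σₖ (z - F k)^e + 1 of degree e vanishes at the r points F i.
    ∑-diff-↑e≈-1 : ∀ z → ∑F (λ k → (z - F k) ↑ e) ≈ - 1#
    ∑-diff-↑e≈-1 z = begin
      Q z                ≈⟨ solve 1 (λ a → a := (a :+ con (+ 1)) :- con (+ 1)) refl (Q z) ⟩
      (Q z + 1#) - 1#    ≈⟨ +-congʳ (PolyFun-vanishes Q+1-poly F F-injective Q+1-vanishes-on-F z) ⟩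
      0# - 1#            ≈⟨ +-identityˡ _ ⟩
      - 1#               ∎
      where
      Q : Carrier → Carrier
      Q z = ∑F (λ k → (z - F k) ↑ e)
      Q+1-poly : PolyFun e (λ z → Q z + 1#)
      Q+1-poly = PolyFun-+ (PolyFun-∑ (List.allFin r) (λ k z → (z - F k) ↑ e) (λ k → PolyFun-pow e (F k))) (PolyFun-const e 1#)
      Q+1-vanishes-on-F : ∀ i → Q (F i) + 1# ≈ 0#
      Q+1-vanishes-on-F i = begin
        Q (F i) + 1#
          ≈⟨ +-congʳ (∑-cong (List.allFin r) (λ k →
               solve 1 (λ a → a := con (+ 1) :- (con (+ 1) :- a)) refl ((F i - F k) ↑ e))) ⟩
        ∑F (λ k → 1# - (1# - (F i - F k) ↑ e)) + 1#
          ≈⟨ +-congʳ (trans (∑-+ (List.allFin r) _ _) (+-cong (∑F-const 1#) (∑-neg (List.allFin r) _))) ⟩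
        (0# + - ∑F (λ k → 1# - (F i - F k) ↑ e)) + 1#
          ≈⟨ +-congʳ (+-congˡ (-‿cong (∑-tabulate-single {m = r} (λ k → k) _ i off-diagonal))) ⟩
        (0# + - (1# - (F i - F i) ↑ e)) + 1#
          ≈⟨ +-congʳ (+-congˡ (-‿cong (+-congˡ (-‿cong (trans (↑-cong e (-‿inverseʳ (F i))) (zeroˡ _)))))) ⟩
        (0# + - (1# - 0#)) + 1#
          ≈⟨ solve 0 ((con (+ 0) :+ :- (con (+ 1) :- con (+ 0))) :+ con (+ 1) := con (+ 0)) refl ⟩
        0# ∎
        where
        off-diagonal : ∀ k → ¬ k ≡ i → 1# - (F i - F k) ↑ e ≈ 0#
        off-diagonal k k≢i = x≈y⇒x-y≈0 (sym (InFr-↑e≈1 (InFr-sub (F-root i) (F-root k)) (F-distinct (λ i≡k → k≢i (Eq.sym i≡k)))))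

    -- 1 at z = F l and 0 at the other points of 𝔽_r, as t ↑ e = 1 for t ∈ 𝔽_r nonzero.
    indicator : Fin r → Carrier → Carrier
    indicator l z = 1# - (z - F l) ↑ e

    ∑-indicator≈1 : ∀ z → ∑F (λ l → indicator l z) ≈ 1#
    ∑-indicator≈1 z = begin
      ∑F (λ l → 1# - (z - F l) ↑ e)
        ≈⟨ ∑-+ (List.allFin r) _ _ ⟩
      ∑F (λ _ → 1#) + ∑F (λ l → - ((z - F l) ↑ e))
        ≈⟨ +-cong (∑F-const 1#) (trans (∑-neg (List.allFin r) _) (-‿cong (∑-diff-↑e≈-1 z))) ⟩
      0# + - - 1#
        ≈⟨ trans (+-identityˡ _) (-‿involutive 1#) ⟩
      1# ∎

    indicator-localises : ∀ {z} l → InFr z → indicator l z * z ≈ indicator l z * F l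
    indicator-localises {z} l z∈Fr = x-y≈0⇒x≈y (begin
      indicator l z * z - indicator l z * F l
        ≈⟨ solve 3 (λ a b y → (con (+ 1) :- a) :* b :- (con (+ 1) :- a) :* y := (b :- y) :- (b :- y) :* a) refl ((z - F l) ↑ e) z (F l) ⟩
      (z - F l) - (z - F l) * (z - F l) ↑ e
        ≈⟨ +-congˡ (-‿cong (InFr-sub z∈Fr (F-root l))) ⟩
      (z - F l) - (z - F l)
        ≈⟨ -‿inverseʳ _ ⟩
      0# ∎)

    -- For τ with values in 𝔽_r, the l-th sum counts (in K) the k with τ k = F l.
    Enumerates : (Fin r → Carrier) → Set ℓ
    Enumerates τ = ∀ l → ∑F (λ k → indicator l (τ k)) ≈ 1#

    enumerates-via : ∀ τ (c : Fin r → Carrier) → (∀ l k → (τ k - F l) ↑ e ≈ (F k - c l) ↑ e) → Enumerates τ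
    enumerates-via τ c τ≈ l = begin
      ∑F (λ k → 1# - (τ k - F l) ↑ e)
        ≈⟨ ∑-+ (List.allFin r) _ _ ⟩
      ∑F (λ _ → 1#) + ∑F (λ k → - ((τ k - F l) ↑ e))
        ≈⟨ +-cong (∑F-const 1#) (trans (∑-neg (List.allFin r) _) (-‿cong (begin
          ∑F (λ k → (τ k - F l) ↑ e)                       ≈⟨ ∑-cong (List.allFin r) (τ≈ l) ⟩
          ∑F (λ k → (F k - c l) ↑ e)                       ≈⟨ ∑-cong (List.allFin r) (λ k → sym (trans (↑-cong e
                 (solve 2 (λ a b → b :- a := :- (a :- b)) refl (F k) (c l))) (neg-↑e _))) ⟩
          ∑F (λ k → (c l - F k) ↑ e)                       ≈⟨ ∑-diff-↑e≈-1 (c l) ⟩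
          - 1#                                             ∎))) ⟩
      0# + - - 1#
        ≈⟨ trans (+-identityˡ _) (-‿involutive 1#) ⟩
      1# ∎

    enumerates-translate : ∀ c → Enumerates (λ k → F k - c)
    enumerates-translate c = enumerates-via _ (λ l → c + F l)
      (λ l k → ↑-cong e (solve 3 (λ x y z → (x :- y) :- z := x :- (y :+ z)) refl (F k) c (F l)))

    enumerates-scale : ∀ {t} → InFr t → Nonzero t → Enumerates (λ k → t * F k)
    enumerates-scale {t} t∈Fr t≉0 = enumerates-via _ (λ l → t ⁻¹ * F l) (λ l k → begin
      (t * F k - F l) ↑ e               ≈⟨ ↑-cong e (+-congˡ (-‿cong (sym (trans (sym (*-assoc _ _ _))
                                             (trans (*-congʳ (⁻¹-inv t t≉0)) (*-identityˡ _)))))) ⟩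
      (t * F k - t * (t ⁻¹ * F l)) ↑ e  ≈⟨ ↑-cong e (solve 3 (λ a b c → a :* b :- a :* c := a :* (b :- c)) refl t (F k) _) ⟩
      (t * (F k - t ⁻¹ * F l)) ↑ e      ≈⟨ *-↑ _ _ e ⟩
      t ↑ e * (F k - t ⁻¹ * F l) ↑ e    ≈⟨ trans (*-congʳ (InFr-↑e≈1 t∈Fr t≉0)) (*-identityˡ _) ⟩
      (F k - t ⁻¹ * F l) ↑ e            ∎)

    -- Equality in K is not decidable, so a sum over 𝔽_r cannot be reindexed by
    -- locating each τ k among the F l.  Instead one multiplies by indicator l z,
    -- which identifies z with F l (indicator-localises); the summands must
    -- respect such scaled equalities.
    ScaledCong : (Carrier → Carrier) → Set (c ⊔ ℓ)
    ScaledCong R = ∀ w z z′ → InFr z → InFr z′ → w * z ≈ w * z′ → w * R z ≈ w * R z′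

    ScaledCong-↑ : ∀ m → ScaledCong (λ z → z ↑ m)
    ScaledCong-↑ m w z z′ _ _ = ↑-scaled-cong m

    ∑F-reindex : ∀ τ → (∀ k → InFr (τ k)) → Enumerates τ → ∀ R → ScaledCong R →
                 ∑F (λ k → R (τ k)) ≈ ∑F (λ l → R (F l))
    ∑F-reindex τ τ∈Fr τ-enum R R-cong = begin
      ∑F (λ k → R (τ k))
        ≈⟨ ∑-cong (List.allFin r) (λ k → sym (trans (∑-*ʳ (List.allFin r) (R (τ k)) _)
             (trans (*-congʳ (∑-indicator≈1 (τ k))) (*-identityˡ _)))) ⟩
      ∑F (λ k → ∑F (λ l → indicator l (τ k) * R (τ k)))
        ≈⟨ ∑-cong (List.allFin r) (λ k → ∑-cong (List.allFin r) (λ l →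
           R-cong _ (τ k) (F l) (τ∈Fr k) (F-root l) (indicator-localises l (τ∈Fr k)))) ⟩
      ∑F (λ k → ∑F (λ l → indicator l (τ k) * R (F l)))
        ≈⟨ ∑-swap (List.allFin r) (List.allFin r) _ ⟩
      ∑F (λ l → ∑F (λ k → indicator l (τ k) * R (F l)))
        ≈⟨ ∑-cong (List.allFin r) (λ l → trans (∑-*ʳ (List.allFin r) (R (F l)) _)
           (trans (*-congʳ (τ-enum l)) (*-identityˡ _))) ⟩
      ∑F (λ l → R (F l)) ∎

    -- Power sums over 𝔽_r

    powerSum : ℕ → Carrier
    powerSum m = ∑F (λ k → F k ↑ m)

    powerSum-e : powerSum e ≈ - 1#
    powerSum-e = trans (∑-cong (List.allFin r) (λ k → trans (sym (neg-↑e (F k))) (↑-cong e (sym (+-identityˡ _)))))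
                       (∑-diff-↑e≈-1 0#)

    -- t^m S = S for every nonzero t ∈ 𝔽_r, where S = powerSum m: a polynomial
    -- identity of degree m < e with e distinct roots, hence S = 0.
    powerSum-below-e : ∀ m → 1 ≤ m → m ≤ r-2 → powerSum m ≈ 0#
    powerSum-below-e m 1≤m m≤r-2 = begin
      S                    ≈⟨ solve 1 (λ a → a := :- ((a :* con (+ 0)) :- a)) refl S ⟩
      - (S * 0# - S)       ≈⟨ -‿cong (+-congʳ (*-congˡ (sym (0↑ 1≤m)))) ⟩
      - (S * 0# ↑ m - S)   ≈⟨ -‿cong (PolyFun-vanishes f-poly pts pts-injective f-vanishes 0#) ⟩
      - 0#                 ≈⟨ -0#≈0# ⟩
      0#                   ∎
      where
      S = powerSum m
      f : Carrier → Carrier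
      f z = S * z ↑ m - S
      f-poly : PolyFun r-2 f
      f-poly = PolyFun-cong (λ z → +-congʳ (*-congˡ (↑-cong m (trans (+-congˡ -0#≈0#) (+-identityʳ z)))))
        (PolyFun-+ (PolyFun-scale S (PolyFun-weaken≤ m≤r-2 (PolyFun-pow m 0#))) (PolyFun-const r-2 (- S)))
      pts : Fin e → Carrier
      pts b = F (Fin.suc b) - F Fin.zero
      pts-injective : ∀ i j → pts i ≈ pts j → i ≡ j
      pts-injective i j ptsᵢ≈ptsⱼ = FinP.suc-injective (F-injective _ _ (begin
        F (Fin.suc i)              ≈⟨ solve 2 (λ a b → a := (a :- b) :+ b) refl (F (Fin.suc i)) (F Fin.zero) ⟩
        pts i + F Fin.zero         ≈⟨ +-congʳ ptsᵢ≈ptsⱼ ⟩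
        pts j + F Fin.zero         ≈⟨ solve 2 (λ a b → (a :- b) :+ b := a) refl (F (Fin.suc j)) (F Fin.zero) ⟩
        F (Fin.suc j)              ∎))
      f-vanishes : ∀ b → f (pts b) ≈ 0#
      f-vanishes b = x≈y⇒x-y≈0 (begin
        S * t ↑ m                  ≈⟨ *-comm _ _ ⟩
        t ↑ m * S                  ≈⟨ sym (∑-*ˡ (List.allFin r) (t ↑ m) _) ⟩
        ∑F (λ k → t ↑ m * F k ↑ m) ≈⟨ ∑-cong (List.allFin r) (λ k → sym (*-↑ t (F k) m)) ⟩
        ∑F (λ k → (t * F k) ↑ m)   ≈⟨ ∑F-reindex (λ k → t * F k) (λ k → InFr-* t∈Fr (F-root k)) (enumerates-scale t∈Fr t≉0)
                                        (λ z → z ↑ m) (ScaledCong-↑ m) ⟩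
        S                          ∎)
        where
        t = pts b
        t∈Fr : InFr t
        t∈Fr = InFr-sub (F-root _) (F-root _)
        t≉0 : Nonzero t
        t≉0 = F-distinct (λ ())

    powerSum-periodic : ∀ m → 1 ≤ m → powerSum (m ℕ.+ e) ≈ powerSum m
    powerSum-periodic (suc k) _ = ∑-cong (List.allFin r) (λ i → InFr-↑-periodic k (F-root i))

    PowerSumValue : ℕ → Set ℓ
    PowerSumValue m = (e ∣ m → powerSum m ≈ - 1#) × (¬ e ∣ m → powerSum m ≈ 0#)

    powerSum-value : ∀ m → 1 ≤ m → PowerSumValue m
    powerSum-value = <-rec (λ m → 1 ≤ m → PowerSumValue m) value
      where
      value : ∀ m → (∀ {m′} → m′ < m → 1 ≤ m′ → PowerSumValue m′) → 1 ≤ m → PowerSumValue m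
      value m rec 1≤m with ℕP.<-cmp m e
      ... | tri< m<e _ _ = (λ e∣m → ⊥-elim (ℕP.<⇒≱ m<e (∣⇒≤ {{ℕ.>-nonZero 1≤m}} e∣m)))
                         , (λ _ → powerSum-below-e m 1≤m (ℕP.≤-pred m<e))
      ... | tri≈ _ Eq.refl _ = (λ _ → powerSum-e) , (λ e∤e → ⊥-elim (e∤e ∣-refl))
      ... | tri> _ _ m>e = Eq.subst PowerSumValue m′+e≡m (shift (rec m′<m 1≤m′))
        where
        m′ = m ℕ.∸ e
        m′+e≡m : m′ ℕ.+ e ≡ m
        m′+e≡m = ℕP.m∸n+n≡m (ℕP.<⇒≤ m>e)
        1≤m′ : 1 ≤ m′
        1≤m′ = ℕP.m<n⇒0<n∸m m>e
        m′<m : m′ < m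
        m′<m = ℕP.∸-monoʳ-< (ℕ.s≤s ℕ.z≤n) (ℕP.<⇒≤ m>e)
        shift : PowerSumValue m′ → PowerSumValue (m′ ℕ.+ e)
        shift (divisible , indivisible) =
            (λ e∣m → trans (powerSum-periodic m′ 1≤m′) (divisible (∣m+n∣m⇒∣n (Eq.subst (e ∣_) (ℕP.+-comm m′ e) e∣m) ∣-refl)))
          , (λ e∤m → trans (powerSum-periodic m′ 1≤m′) (indivisible (λ e∣m′ → e∤m (Eq.subst (e ∣_) (ℕP.+-comm e m′) (∣m∣n⇒∣m+n ∣-refl e∣m′)))))

    -- t ↑ invExponent j = t⁻ʲ for nonzero t ∈ 𝔽_r: invExponent j ≡ - j (mod e) and is ≥ 1.
    invExponent : ℕ → ℕ
    invExponent j = r-2 ℕ.* j ℕ.+ e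

    1≤invExponent : ∀ j → 1 ≤ invExponent j
    1≤invExponent j = ℕP.≤-trans (ℕ.s≤s ℕ.z≤n) (ℕP.m≤n+m e (r-2 ℕ.* j))

    e∣invExponent⇒e∣j : ∀ j → e ∣ invExponent j → e ∣ j
    e∣invExponent⇒e∣j j e∣M = ∣m+n∣m⇒∣n (Eq.subst (e ∣_) (ℕP.+-comm j (r-2 ℕ.* j)) (∣m⇒∣m*n j ∣-refl)) e∣r-2*j
      where
      e∣r-2*j : e ∣ r-2 ℕ.* j
      e∣r-2*j = ∣m+n∣m⇒∣n (Eq.subst (e ∣_) (ℕP.+-comm (r-2 ℕ.* j) e) e∣M) ∣-refl

    e∣j⇒e∣invExponent : ∀ j → e ∣ j → e ∣ invExponent j
    e∣j⇒e∣invExponent j e∣j = ∣m∣n⇒∣m+n (Eq.subst (e ∣_) (ℕP.*-comm j r-2) (∣m⇒∣m*n r-2 e∣j)) ∣-refl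

    sign-e∣ : ∀ j → e ∣ j → sign j ≈ 1#
    sign-e∣ j (divides t Eq.refl) = trans (≈-reflexive (Eq.cong sign (ℕP.*-comm t e)))
      (trans (↑-* (- 1#) e t) (trans (↑-cong t (InFr-↑e≈1 (InFr-neg InFr-1) (-‿nonzero 1-nonzero))) (1↑ t)))

    -- Partial fraction coefficients times the power sum give Δ^{i,j}_{s₁,s₂}.  The
    -- `with` on e ∣? j also reduces Δ r s₁ s₂ j, which tests the same divisibility.
    Δ-value : ∀ s₁′ s₂′ k → let s₁ = suc s₁′; s₂ = suc s₂′; j = suc k in
      (sign (j ℕ.+ s₂) * binom s₂ j ×1 + sign s₁ * binom s₁ j ×1 * sign j) * powerSum (invExponent j) ≈ ℤ→K (Δ r s₁ s₂ j)
    Δ-value s₁′ s₂′ k with e ∣? suc k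
    ... | no e∤j  = trans (*-congˡ (proj₂ (powerSum-value _ (1≤invExponent (suc k))) (λ e∣M → e∤j (e∣invExponent⇒e∣j (suc k) e∣M))))
                          (zeroʳ _)
    ... | yes e∣j = begin
      (sign (j ℕ.+ suc s₂′) * binom (suc s₂′) j ×1 + sign (suc s₁′) * binom (suc s₁′) j ×1 * sign j) * powerSum (invExponent j)
        ≈⟨ *-cong (+-cong (*-cong (trans (sign-+ j (suc s₂′)) (*-cong (sign-e∣ j e∣j) (sign-suc s₂′))) (≈-reflexive (Eq.cong _×1 (binom-suc-suc s₂′ k))))
                          (*-cong (*-cong (sign-suc s₁′) (≈-reflexive (Eq.cong _×1 (binom-suc-suc s₁′ k)))) (sign-e∣ j e∣j)))
                  (proj₁ (powerSum-value _ (1≤invExponent j)) (e∣j⇒e∣invExponent j e∣j)) ⟩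
      (1# * - sign s₂′ * (k C s₂′) ×1 + - sign s₁′ * (k C s₁′) ×1 * 1#) * - 1#
        ≈⟨ solve 4 (λ a b c d → (con (+ 1) :* :- a :* b :+ :- c :* d :* con (+ 1)) :* (:- con (+ 1)) := c :* d :+ a :* b)
                 refl (sign s₂′) ((k C s₂′) ×1) (sign s₁′) ((k C s₁′) ×1) ⟩
      sign s₁′ * (k C s₁′) ×1 + sign s₂′ * (k C s₂′) ×1
        ≈⟨ sym (+-cong (trans (ℤ→K-* (sgn s₁′) _) (*-congʳ (ℤ→K-sgn s₁′))) (trans (ℤ→K-* (sgn s₂′) _) (*-congʳ (ℤ→K-sgn s₂′)))) ⟩
      ℤ→K (sgn s₁′ ℤ.* + (k C s₁′)) + ℤ→K (sgn s₂′ ℤ.* + (k C s₂′))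
        ≈⟨ sym (ℤ→K-+ (sgn s₁′ ℤ.* + (k C s₁′)) (sgn s₂′ ℤ.* + (k C s₂′))) ⟩
      ℤ→K (sgn s₁′ ℤ.* + (k C s₁′) ℤ.+ sgn s₂′ ℤ.* + (k C s₂′)) ∎
      where
      j = suc k

    module CarlitzSums (θ u : Carrier) (D : ℕ)
      (Cmonic≉0 : ∀ m → m < D → (cs : Vec (Fin r) m) → ¬ (Cmonic r F θ cs u ≈ 0#))
      where

      Cθ : ℕ → Carrier
      Cθ i = Cθ^ r F θ i u

      -- C_a(u) for a = Σ_{i<m} y i θ^i, by 𝔽_r-linearity of the Carlitz module
      Cpoly : ℕ → (ℕ → Carrier) → Carrier
      Cpoly m y = Σ< m (λ i → y i * Cθ i)

      coeffs : ∀ {m} → Vec (Fin r) m → ℕ → Carrier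
      coeffs = coeffAt r F θ

      ∑A< : ∀ m → (Vec (Fin r) m → Carrier) → Carrier
      ∑A< m = ∑ (allVecs r m)

      ∑A<-cong : ∀ m {f g} → (∀ v → f v ≈ g v) → ∑A< m f ≈ ∑A< m g
      ∑A<-cong m = ∑-cong (allVecs r m)

      ∑A<-suc : ∀ m f → ∑A< (suc m) f ≈ ∑F (λ x → ∑A< m (λ v → f (x ∷ v)))
      ∑A<-suc m f = trans (∑-concatMap (List.allFin r) (λ x → List.map (x ∷_) (allVecs r m)) f)
                          (∑-cong (List.allFin r) (λ x → ∑-map (allVecs r m) (x ∷_) f))

      ∑A<-∑F-swap : ∀ m (f : Vec (Fin r) m → Fin r → Carrier) → ∑A< m (λ v → ∑F (f v)) ≈ ∑F (λ x → ∑A< m (λ v → f v x))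
      ∑A<-∑F-swap m f = ∑-swap (allVecs r m) (List.allFin r) f

      ∑A<-∷ʳ : ∀ m f → ∑A< (suc m) f ≈ ∑A< m (λ b → ∑F (λ x → f (b Vec.∷ʳ x)))
      ∑A<-∷ʳ zero    f = trans (∑A<-suc zero f) (trans (∑-cong (List.allFin r) (λ x → +-identityʳ _)) (sym (+-identityʳ _)))
      ∑A<-∷ʳ (suc m) f = begin
        ∑A< (2+ m) f                                          ≈⟨ ∑A<-suc (suc m) f ⟩
        ∑F (λ x₀ → ∑A< (suc m) (λ v → f (x₀ ∷ v)))            ≈⟨ ∑-cong (List.allFin r) (λ x₀ → ∑A<-∷ʳ m (λ v → f (x₀ ∷ v))) ⟩
        ∑F (λ x₀ → ∑A< m (λ b → ∑F (λ x → f (x₀ ∷ (b Vec.∷ʳ x))))) ≈⟨ sym (∑A<-suc m _) ⟩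
        ∑A< (suc m) (λ b → ∑F (λ x → f (b Vec.∷ʳ x)))         ∎

      ∑A<-single : ∀ m (a : Vec (Fin r) m) f → (∀ b → ¬ b ≡ a → f b ≈ 0#) → ∑A< m f ≈ f a
      ∑A<-single zero    []      f _   = +-identityʳ _
      ∑A<-single (suc m) (x ∷ a) f f≈0 = begin
        ∑A< (suc m) f
          ≈⟨ ∑A<-suc m f ⟩
        ∑F (λ x′ → ∑A< m (λ v → f (x′ ∷ v)))
          ≈⟨ ∑-tabulate-single {m = r} (λ k → k) _ x (λ x′ x′≢x →
            ∑-zero (allVecs r m) _ (λ v → f≈0 (x′ ∷ v) (λ eq → x′≢x (VecP.∷-injectiveˡ eq)))) ⟩
        ∑A< m (λ v → f (x ∷ v))
          ≈⟨ ∑A<-single m a (λ v → f (x ∷ v)) (λ v v≢a → f≈0 (x ∷ v) (λ eq → v≢a (VecP.∷-injectiveʳ eq))) ⟩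
        f (x ∷ a) ∎

      FrSeq : (ℕ → Carrier) → Set ℓ
      FrSeq y = ∀ i → InFr (y i)

      ScaledCongSeq : ((ℕ → Carrier) → Carrier) → Set (c ⊔ ℓ)
      ScaledCongSeq G = ∀ v y y′ → FrSeq y → FrSeq y′ → (∀ i → v * y i ≈ v * y′ i) → v * G y ≈ v * G y′

      ScaledCongSeq⇒cong : ∀ {G} → ScaledCongSeq G → ∀ {y y′} → FrSeq y → FrSeq y′ → (∀ i → y i ≈ y′ i) → G y ≈ G y′
      ScaledCongSeq⇒cong {G} G-cong {y} {y′} y∈Fr y′∈Fr y≈y′ = begin
        G y       ≈⟨ sym (*-identityˡ _) ⟩
        1# * G y  ≈⟨ G-cong 1# y y′ y∈Fr y′∈Fr (λ i → *-congˡ (y≈y′ i)) ⟩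
        1# * G y′ ≈⟨ *-identityˡ _ ⟩
        G y′      ∎

      cons : Carrier → (ℕ → Carrier) → ℕ → Carrier
      cons a y zero    = a
      cons a y (suc i) = y i

      FrSeq-cons : ∀ {a y} → InFr a → FrSeq y → FrSeq (cons a y)
      FrSeq-cons a∈Fr y∈Fr zero    = a∈Fr
      FrSeq-cons a∈Fr y∈Fr (suc i) = y∈Fr i

      FrSeq-coeffs : ∀ {m} (cs : Vec (Fin r) m) → FrSeq (coeffs cs)
      FrSeq-coeffs []       i       = InFr-0
      FrSeq-coeffs (x ∷ cs) zero    = F-root x
      FrSeq-coeffs (x ∷ cs) (suc i) = FrSeq-coeffs cs i

      coeffs-∷ : ∀ {m} x (cs : Vec (Fin r) m) i → coeffs (x ∷ cs) i ≈ cons (F x) (coeffs cs) i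
      coeffs-∷ x cs zero    = refl
      coeffs-∷ x cs (suc i) = refl

      ScaledCongSeq-tail : ∀ {G} → ScaledCongSeq G → ∀ {a} → InFr a → ScaledCongSeq (λ y → G (cons a y))
      ScaledCongSeq-tail G-cong a∈Fr v y y′ y∈Fr y′∈Fr vy≈vy′ =
        G-cong v _ _ (FrSeq-cons a∈Fr y∈Fr) (FrSeq-cons a∈Fr y′∈Fr) (λ { zero → refl ; (suc i) → vy≈vy′ i })

      ScaledCong-head : ∀ {G} → ScaledCongSeq G → ∀ {y} → FrSeq y → ScaledCong (λ z → G (cons z y))
      ScaledCong-head G-cong y∈Fr v z z′ z∈Fr z′∈Fr vz≈vz′ =
        G-cong v _ _ (FrSeq-cons z∈Fr y∈Fr) (FrSeq-cons z′∈Fr y∈Fr) (λ { zero → vz≈vz′ ; (suc i) → refl })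

      nonzero-on-Fr : ∀ B → ScaledCong B → (∀ l → Nonzero (B (F l))) → ∀ {z} → InFr z → Nonzero (B z)
      nonzero-on-Fr B B-cong BF≉0 {z} z∈Fr Bz≈0 = 1-nonzero (begin
        1#                         ≈⟨ sym (∑-indicator≈1 z) ⟩
        ∑F (λ l → indicator l z)   ≈⟨ ∑-zero (List.allFin r) _ (λ l → *-cancelʳ-zero (BF≉0 l) (begin
            indicator l z * B (F l)    ≈⟨ sym (B-cong (indicator l z) z (F l) z∈Fr (F-root l) (indicator-localises l z∈Fr)) ⟩
            indicator l z * B z        ≈⟨ *-congˡ Bz≈0 ⟩
            indicator l z * 0#         ≈⟨ zeroʳ _ ⟩
            0#                         ∎)) ⟩
        0#                         ∎)

      nonzero-on-FrSeq : ∀ m G → ScaledCongSeq G → (∀ (cs : Vec (Fin r) m) → Nonzero (G (coeffs cs))) →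
                         ∀ y → FrSeq y → (∀ i → m ≤ i → y i ≈ 0#) → Nonzero (G y)
      nonzero-on-FrSeq zero G G-cong G≉0 y y∈Fr y≈0 Gy≈0 =
        G≉0 [] (trans (sym (ScaledCongSeq⇒cong G-cong y∈Fr (λ _ → InFr-0) (λ i → y≈0 i ℕ.z≤n))) Gy≈0)
      nonzero-on-FrSeq (suc m) G G-cong G≉0 y y∈Fr y≈0 Gy≈0 =
        nonzero-on-Fr B (ScaledCong-head G-cong (λ i → y∈Fr (suc i))) B≉0 (y∈Fr 0)
          (trans (ScaledCongSeq⇒cong G-cong (FrSeq-cons (y∈Fr 0) (λ i → y∈Fr (suc i))) y∈Fr (λ { zero → refl ; (suc i) → refl })) Gy≈0)
        where
        B : Carrier → Carrier
        B z = G (cons z (λ i → y (suc i)))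
        B≉0 : ∀ l → Nonzero (B (F l))
        B≉0 l = nonzero-on-FrSeq m (λ y′ → G (cons (F l) y′)) (ScaledCongSeq-tail G-cong (F-root l))
          (λ cs eq → G≉0 (l ∷ cs) (trans (ScaledCongSeq⇒cong G-cong (FrSeq-coeffs (l ∷ cs)) (FrSeq-cons (F-root l) (FrSeq-coeffs cs)) (coeffs-∷ l cs)) eq))
          (λ i → y (suc i)) (λ i → y∈Fr (suc i)) (λ i m≤i → y≈0 (suc i) (ℕ.s≤s m≤i))

      Cpoly-cong : ∀ m {y y′} → (∀ i → i < m → y i ≈ y′ i) → Cpoly m y ≈ Cpoly m y′
      Cpoly-cong m y≈y′ = Σ<-cong m (λ i i<m → *-congʳ (y≈y′ i i<m))

      Cpoly-scaled-cong : ∀ m v {y y′} → (∀ i → v * y i ≈ v * y′ i) → v * Cpoly m y ≈ v * Cpoly m y′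
      Cpoly-scaled-cong m v {y} {y′} vy≈vy′ = begin
        v * Cpoly m y
          ≈⟨ sym (Σ<-*ˡ m v _) ⟩
        Σ< m (λ i → v * (y i * Cθ i))
          ≈⟨ Σ<-cong m (λ i _ → trans (sym (*-assoc _ _ _)) (trans (*-congʳ (vy≈vy′ i)) (*-assoc _ _ _))) ⟩
        Σ< m (λ i → v * (y′ i * Cθ i))
          ≈⟨ Σ<-*ˡ m v _ ⟩
        v * Cpoly m y′ ∎

      Cpoly-scale : ∀ m a y → Cpoly m (λ i → a * y i) ≈ a * Cpoly m y
      Cpoly-scale m a y = trans (Σ<-cong m (λ i _ → *-assoc _ _ _)) (Σ<-*ˡ m a _)

      Cpoly-sub : ∀ m y y′ → Cpoly m (λ i → y i - y′ i) ≈ Cpoly m y - Cpoly m y′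
      Cpoly-sub m y y′ = begin
        Σ< m (λ i → (y i - y′ i) * Cθ i)
          ≈⟨ Σ<-cong m (λ i _ → solve 3 (λ a b c → (a :- b) :* c := a :* c :+ :- (b :* c)) refl (y i) (y′ i) (Cθ i)) ⟩
        Σ< m (λ i → y i * Cθ i + - (y′ i * Cθ i))
          ≈⟨ Σ<-+ m _ _ ⟩
        Cpoly m y + Σ< m (λ i → - (y′ i * Cθ i))
          ≈⟨ +-congˡ (Σ<-neg m _) ⟩
        Cpoly m y - Cpoly m y′ ∎

      truncate : ℕ → (ℕ → Carrier) → ℕ → Carrier
      truncate m y i with i ℕP.<? m
      ... | yes _ = y i
      ... | no  _ = 0#

      FrSeq-truncate : ∀ m {y} → FrSeq y → FrSeq (truncate m y)
      FrSeq-truncate m y∈Fr i with i ℕP.<? m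
      ... | yes _ = y∈Fr i
      ... | no  _ = InFr-0

      truncate-< : ∀ m y i → i < m → truncate m y i ≈ y i
      truncate-< m y i i<m with i ℕP.<? m
      ... | yes _   = refl
      ... | no  i≮m = ⊥-elim (i≮m i<m)

      truncate-≥ : ∀ m y i → m ≤ i → truncate m y i ≈ 0#
      truncate-≥ m y i m≤i with i ℕP.<? m
      ... | yes i<m = ⊥-elim (ℕP.<⇒≱ i<m m≤i)
      ... | no  _   = refl

      -- The hypothesis covers monic a with coefficients F l; nonzero-on-FrSeq
      -- extends it to arbitrary coefficients in 𝔽_r.
      Cmonic-nonzero : ∀ m → m < D → ∀ y → FrSeq y → Nonzero (Cθ m + Cpoly m y)
      Cmonic-nonzero m m<D y y∈Fr eq =
        nonzero-on-FrSeq m (λ y → Cθ m + Cpoly m y) G-cong (Cmonic≉0 m m<D) (truncate m y) (FrSeq-truncate m y∈Fr) (truncate-≥ m y)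
          (trans (+-congˡ (Cpoly-cong m (λ i i<m → truncate-< m y i i<m))) eq)
        where
        G-cong : ScaledCongSeq (λ y → Cθ m + Cpoly m y)
        G-cong v y y′ _ _ vy≈vy′ = trans (distribˡ _ _ _) (trans (+-congˡ (Cpoly-scaled-cong m v vy≈vy′)) (sym (distribˡ _ _ _)))

      C-nonzero : ∀ m → m < D → ∀ {t} → InFr t → Nonzero t → ∀ y → FrSeq y → Nonzero (t * Cθ m + Cpoly m y)
      C-nonzero m m<D {t} t∈Fr t≉0 y y∈Fr eq =
        *-nonzero t≉0 (Cmonic-nonzero m m<D (λ i → t ⁻¹ * y i) (λ i → InFr-* (InFr-⁻¹ t∈Fr t≉0) (y∈Fr i))) (begin
          t * (Cθ m + Cpoly m (λ i → t ⁻¹ * y i)) ≈⟨ *-congˡ (+-congˡ (Cpoly-scale m (t ⁻¹) y)) ⟩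
          t * (Cθ m + t ⁻¹ * Cpoly m y)           ≈⟨ solve 4 (λ t a b c → t :* (a :+ b :* c) := t :* a :+ (t :* b) :* c) refl t (Cθ m) (t ⁻¹) (Cpoly m y) ⟩
          t * Cθ m + (t * t ⁻¹) * Cpoly m y       ≈⟨ +-congˡ (trans (*-congʳ (⁻¹-inv t t≉0)) (*-identityˡ _)) ⟩
          t * Cθ m + Cpoly m y                    ≈⟨ eq ⟩
          0#                                      ∎)

      u≉0 : 0 < D → Nonzero u
      u≉0 0<D u≈0 = Cmonic≉0 0 0<D [] (trans (+-identityʳ u) u≈0)

      coeffsVia : ∀ {m} → (ℕ → Fin r → Carrier) → Vec (Fin r) m → ℕ → Carrier
      coeffsVia τ []       i       = 0#
      coeffsVia τ (x ∷ xs) zero    = τ 0 x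
      coeffsVia τ (x ∷ xs) (suc i) = coeffsVia (λ i → τ (suc i)) xs i

      FrSeq-coeffsVia : ∀ {m} τ → (∀ i k → InFr (τ i k)) → (b : Vec (Fin r) m) → FrSeq (coeffsVia τ b)
      FrSeq-coeffsVia τ τ∈Fr []      i       = InFr-0
      FrSeq-coeffsVia τ τ∈Fr (x ∷ b) zero    = τ∈Fr 0 x
      FrSeq-coeffsVia τ τ∈Fr (x ∷ b) (suc i) = FrSeq-coeffsVia (λ i → τ (suc i)) (λ i → τ∈Fr (suc i)) b i

      ∑A<-reindex : ∀ m τ → (∀ i k → InFr (τ i k)) → (∀ i → Enumerates (τ i)) → ∀ G → ScaledCongSeq G →
                    ∑A< m (λ b → G (coeffsVia τ b)) ≈ ∑A< m (λ b → G (coeffs b))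
      ∑A<-reindex zero    τ τ∈Fr τ-enum G G-cong = +-congʳ (ScaledCongSeq⇒cong G-cong (FrSeq-coeffsVia τ τ∈Fr []) (FrSeq-coeffs []) (λ i → refl))
      ∑A<-reindex (suc m) τ τ∈Fr τ-enum G G-cong = begin
        ∑A< (suc m) (λ b → G (coeffsVia τ b))
          ≈⟨ ∑A<-suc m _ ⟩
        ∑F (λ x → ∑A< m (λ v → G (coeffsVia τ (x ∷ v))))
          ≈⟨ ∑-cong (List.allFin r) (λ x → ∑A<-cong m (λ v →
               ScaledCongSeq⇒cong G-cong (FrSeq-coeffsVia τ τ∈Fr (x ∷ v))
                 (FrSeq-cons (τ∈Fr 0 x) (FrSeq-coeffsVia τ′ τ′∈Fr v)) (λ { zero → refl ; (suc i) → refl }))) ⟩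
        ∑F (λ x → ∑A< m (λ v → G (cons (τ 0 x) (coeffsVia τ′ v))))
          ≈⟨ ∑-cong (List.allFin r) (λ x →
              ∑A<-reindex m τ′ τ′∈Fr (λ i → τ-enum (suc i)) _ (ScaledCongSeq-tail G-cong (τ∈Fr 0 x))) ⟩
        ∑F (λ x → ∑A< m (λ v → G (cons (τ 0 x) (coeffs v))))
          ≈⟨ sym (∑A<-∑F-swap m _) ⟩
        ∑A< m (λ v → ∑F (λ x → G (cons (τ 0 x) (coeffs v))))
          ≈⟨ ∑A<-cong m (λ v → ∑F-reindex (τ 0) (τ∈Fr 0) (τ-enum 0)
              (λ z → G (cons z (coeffs v))) (ScaledCong-head G-cong (FrSeq-coeffs v))) ⟩
        ∑A< m (λ v → ∑F (λ l → G (cons (F l) (coeffs v))))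
          ≈⟨ ∑A<-∑F-swap m _ ⟩
        ∑F (λ l → ∑A< m (λ v → G (cons (F l) (coeffs v))))
          ≈⟨ ∑-cong (List.allFin r) (λ l → ∑A<-cong m (λ v →
              ScaledCongSeq⇒cong G-cong (FrSeq-cons (F-root l) (FrSeq-coeffs v)) (FrSeq-coeffs (l ∷ v))
                (λ { zero → refl ; (suc i) → refl }))) ⟩
        ∑F (λ l → ∑A< m (λ v → G (coeffs (l ∷ v))))
          ≈⟨ sym (∑A<-suc m _) ⟩
        ∑A< (suc m) (λ b → G (coeffs b)) ∎
        where
        τ′ = λ i → τ (suc i)
        τ′∈Fr = λ i → τ∈Fr (suc i)

      coeffsVia-translate : ∀ {m} (a b : Vec (Fin r) m) i → coeffsVia (λ i k → F k - coeffs a i) b i ≈ coeffs b i - coeffs a i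
      coeffsVia-translate []      []      i       = sym (-‿inverseʳ 0#)
      coeffsVia-translate (y ∷ a) (x ∷ b) zero    = refl
      coeffsVia-translate (y ∷ a) (x ∷ b) (suc i) = coeffsVia-translate a b i

      coeffsVia-scale : ∀ {m} t (b : Vec (Fin r) m) i → coeffsVia (λ _ k → t * F k) b i ≈ t * coeffs b i
      coeffsVia-scale t []      i       = sym (zeroʳ t)
      coeffsVia-scale t (x ∷ b) zero    = refl
      coeffsVia-scale t (x ∷ b) (suc i) = coeffsVia-scale t b i

      coeffs-∷ʳ-< : ∀ {m} (b : Vec (Fin r) m) x i → i < m → coeffs (b Vec.∷ʳ x) i ≡ coeffs b i
      coeffs-∷ʳ-< (y ∷ b) x zero    _           = Eq.refl
      coeffs-∷ʳ-< (y ∷ b) x (suc i) (ℕ.s≤s i<m) = coeffs-∷ʳ-< b x i i<m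

      coeffs-∷ʳ-last : ∀ {m} (b : Vec (Fin r) m) x → coeffs (b Vec.∷ʳ x) m ≡ F x
      coeffs-∷ʳ-last []      x = Eq.refl
      coeffs-∷ʳ-last (y ∷ b) x = coeffs-∷ʳ-last b x

      Cpoly-∷ʳ : ∀ {m} (b : Vec (Fin r) m) x → Cpoly (suc m) (coeffs (b Vec.∷ʳ x)) ≈ Cpoly m (coeffs b) + F x * Cθ m
      Cpoly-∷ʳ {m} b x = +-cong (Cpoly-cong m (λ i i<m → ≈-reflexive (coeffs-∷ʳ-< b x i i<m)))
                                (*-congʳ (≈-reflexive (coeffs-∷ʳ-last b x)))

      Cpoly-diff-∷ʳ : ∀ {m} (a b : Vec (Fin r) m) xa x →
                      Cpoly (suc m) (coeffs (b Vec.∷ʳ x)) - Cpoly (suc m) (coeffs (a Vec.∷ʳ xa))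
                        ≈ (F x - F xa) * Cθ m + (Cpoly m (coeffs b) - Cpoly m (coeffs a))
      Cpoly-diff-∷ʳ {m} a b xa x = trans (+-cong (Cpoly-∷ʳ b x) (-‿cong (Cpoly-∷ʳ a xa)))
        (solve 5 (λ lb la fx fa c → (lb :+ fx :* c) :- (la :+ fa :* c) := (fx :- fa) :* c :+ (lb :- la))
               refl (Cpoly m (coeffs b)) (Cpoly m (coeffs a)) (F x) (F xa) (Cθ m))

      Cpoly-injective : ∀ m → m ≤ D → ∀ (a b : Vec (Fin r) m) → ¬ b ≡ a → Nonzero (Cpoly m (coeffs b) - Cpoly m (coeffs a))
      Cpoly-injective zero    _      []  []  b≢a = ⊥-elim (b≢a Eq.refl)
      Cpoly-injective (suc m) 1+m≤D a b b≢a with Vec.initLast a | Vec.initLast b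
      ... | a′ , xa , Eq.refl | b′ , x , Eq.refl = λ eq → last-step (trans (sym (Cpoly-diff-∷ʳ a′ b′ xa x)) eq)
        where
        last-step : Nonzero ((F x - F xa) * Cθ m + (Cpoly m (coeffs b′) - Cpoly m (coeffs a′)))
        last-step with x FinP.≟ xa
        ... | no x≢xa = λ eq → C-nonzero m 1+m≤D (InFr-sub (F-root x) (F-root xa)) (F-distinct x≢xa) (λ i → coeffs b′ i - coeffs a′ i)
                                 (λ i → InFr-sub (FrSeq-coeffs b′ i) (FrSeq-coeffs a′ i)) (trans (+-congˡ (Cpoly-sub m (coeffs b′) (coeffs a′))) eq)
        ... | yes Eq.refl = λ eq → Cpoly-injective m (ℕP.<⇒≤ 1+m≤D) a′ b′ (λ b′≡a′ → b≢a (Eq.cong (Vec._∷ʳ xa) b′≡a′))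
                                 (trans (sym (trans (+-congʳ (trans (*-congʳ (-‿inverseʳ (F x))) (zeroˡ _))) (+-identityˡ _))) eq)

      module InversePowers (j : ℕ) (1≤j : 1 ≤ j) where

        bracket⁻ʲ : Carrier → Carrier
        bracket⁻ʲ y = ((y * u ⁻¹) ⁻¹) ↑ j

        M : ℕ
        M = invExponent j

        Hʲ : ℕ → Carrier
        Hʲ m = H r F θ m j u

        bracket⁻ʲ-cong : ∀ {x y} → x ≈ y → bracket⁻ʲ x ≈ bracket⁻ʲ y
        bracket⁻ʲ-cong x≈y = ↑-cong j (⁻¹-cong (*-congʳ x≈y))

        bracket⁻ʲ-zero : ∀ {x} → x ≈ 0# → bracket⁻ʲ x ≈ 0#
        bracket⁻ʲ-zero x≈0 = trans (↑-cong j (⁻¹-zero (trans (*-congʳ x≈0) (zeroˡ _)))) (0↑ 1≤j)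

        bracket⁻ʲ-scaled-cong : 0 < D → ∀ v {X X′} → Nonzero X → Nonzero X′ →
                                v * X ≈ v * X′ → v * bracket⁻ʲ X ≈ v * bracket⁻ʲ X′
        bracket⁻ʲ-scaled-cong 0<D v X≉0 X′≉0 vX≈vX′ = ↑-scaled-cong j
          (⁻¹-scaled-cong v (*-nonzero X≉0 (⁻¹-nonzero (u≉0 0<D))) (*-nonzero X′≉0 (⁻¹-nonzero (u≉0 0<D)))
             (trans (sym (*-assoc _ _ _)) (trans (*-congʳ vX≈vX′) (*-assoc _ _ _))))

        bracket⁻ʲ-scale : 0 < D → ∀ {t X} → InFr t → Nonzero t → Nonzero X → bracket⁻ʲ (t * X) ≈ t ↑ M * bracket⁻ʲ X
        bracket⁻ʲ-scale 0<D {t} {X} t∈Fr t≉0 X≉0 = begin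
          ((t * X * u ⁻¹) ⁻¹) ↑ j
            ≈⟨ ↑-cong j (⁻¹-cong (*-assoc _ _ _)) ⟩
          ((t * (X * u ⁻¹)) ⁻¹) ↑ j
            ≈⟨ ↑-cong j (⁻¹-* t≉0 (*-nonzero X≉0 (⁻¹-nonzero (u≉0 0<D)))) ⟩
          (t ⁻¹ * (X * u ⁻¹) ⁻¹) ↑ j
            ≈⟨ *-↑ _ _ j ⟩
          (t ⁻¹) ↑ j * bracket⁻ʲ X
            ≈⟨ *-congʳ (trans (↑-cong j (⁻¹-unique t≉0 (InFr-↑e≈1 t∈Fr t≉0))) (sym (↑-* t r-2 j))) ⟩
          t ↑ (r-2 ℕ.* j) * bracket⁻ʲ X
            ≈⟨ *-congʳ (sym (trans (↑-+ t (r-2 ℕ.* j) e) (trans (*-congˡ (InFr-↑e≈1 t∈Fr t≉0)) (*-identityʳ _)))) ⟩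
          t ↑ M * bracket⁻ʲ X ∎

        diffSum : ∀ m → Vec (Fin r) m → Carrier
        diffSum m a = ∑A< m (λ b → bracket⁻ʲ (Cpoly m (coeffs b) - Cpoly m (coeffs a)))

        shiftedDiffSum : ∀ m → Vec (Fin r) m → Fin r → Fin r → Carrier
        shiftedDiffSum m a xa x = ∑A< m (λ b → bracket⁻ʲ ((F x - F xa) * Cθ m + (Cpoly m (coeffs b) - Cpoly m (coeffs a))))

        -- Translating by a and scaling by t = F x - F xa permute A_{<m}, which
        -- turns the shifted sum into t ↑ M times the sum defining H_m.
        shiftedDiffSum-off-diagonal : ∀ m → m < D → (a : Vec (Fin r) m) → ∀ xa x → ¬ x ≡ xa →
                                      shiftedDiffSum m a xa x ≈ (F x - F xa) ↑ M * Hʲ m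
        shiftedDiffSum-off-diagonal m m<D a xa x x≢xa = begin
          shiftedDiffSum m a xa x
            ≈⟨ ∑A<-cong m (λ b → bracket⁻ʲ-cong (+-congˡ (sym (trans
                 (Cpoly-cong m (λ i _ → coeffsVia-translate a b i)) (Cpoly-sub m (coeffs b) (coeffs a)))))) ⟩
          ∑A< m (λ b → G (coeffsVia translate b))
            ≈⟨ ∑A<-reindex m translate (λ i k → InFr-sub (F-root k) (FrSeq-coeffs a i))
                 (λ i → enumerates-translate (coeffs a i)) G G-cong ⟩
          ∑A< m (λ b → G (coeffs b))
            ≈⟨ sym (∑A<-reindex m (λ _ k → t * F k) (λ i k → InFr-* t∈Fr (F-root k))
                 (λ i → enumerates-scale t∈Fr t≉0) G G-cong) ⟩
          ∑A< m (λ b → G (coeffsVia (λ _ k → t * F k) b))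
            ≈⟨ ∑A<-cong m (λ b → bracket⁻ʲ-cong (begin
              t * Cθ m + Cpoly m (coeffsVia (λ _ k → t * F k) b) ≈⟨ +-congˡ (trans (Cpoly-cong m (λ i _ → coeffsVia-scale t b i)) (Cpoly-scale m t (coeffs b))) ⟩
              t * Cθ m + t * Cpoly m (coeffs b)                  ≈⟨ sym (distribˡ _ _ _) ⟩
              t * (Cθ m + Cpoly m (coeffs b))                    ∎)) ⟩
          ∑A< m (λ b → bracket⁻ʲ (t * (Cθ m + Cpoly m (coeffs b))))
            ≈⟨ ∑A<-cong m (λ b → bracket⁻ʲ-scale 0<D t∈Fr t≉0 (Cmonic-nonzero m m<D (coeffs b) (FrSeq-coeffs b))) ⟩
          ∑A< m (λ b → t ↑ M * bracket⁻ʲ (Cθ m + Cpoly m (coeffs b)))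
            ≈⟨ ∑-*ˡ (allVecs r m) _ _ ⟩
          t ↑ M * Hʲ m ∎
          where
          0<D : 0 < D
          0<D = ℕP.≤-<-trans ℕ.z≤n m<D
          t = F x - F xa
          t∈Fr : InFr t
          t∈Fr = InFr-sub (F-root x) (F-root xa)
          t≉0 : Nonzero t
          t≉0 = F-distinct x≢xa
          translate : ℕ → Fin r → Carrier
          translate i k = F k - coeffs a i
          G : (ℕ → Carrier) → Carrier
          G y = bracket⁻ʲ (t * Cθ m + Cpoly m y)
          G-cong : ScaledCongSeq G
          G-cong v y y′ y∈Fr y′∈Fr vy≈vy′ = bracket⁻ʲ-scaled-cong 0<D v (C-nonzero m m<D t∈Fr t≉0 y y∈Fr) (C-nonzero m m<D t∈Fr t≉0 y′ y′∈Fr)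
            (trans (distribˡ _ _ _) (trans (+-congˡ (Cpoly-scaled-cong m v vy≈vy′)) (sym (distribˡ _ _ _))))

        shiftedDiffSum-diagonal : ∀ m (a : Vec (Fin r) m) xa → shiftedDiffSum m a xa xa ≈ diffSum m a
        shiftedDiffSum-diagonal m a xa = ∑A<-cong m (λ b → bracket⁻ʲ-cong
          (trans (+-congʳ (trans (*-congʳ (-‿inverseʳ (F xa))) (zeroˡ _))) (+-identityˡ _)))

        ∑F-shiftedDiffSum : ∀ m → m < D → (a : Vec (Fin r) m) → ∀ xa →
                            ∑F (shiftedDiffSum m a xa) ≈ diffSum m a + powerSum M * Hʲ m
        ∑F-shiftedDiffSum m m<D a xa = begin
          ∑F T
            ≈⟨ ∑-cong (List.allFin r) (λ x → solve 2 (λ a b → a := (a :- b) :+ b) refl (T x) (P x)) ⟩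
          ∑F (λ x → (T x - P x) + P x)
            ≈⟨ ∑-+ (List.allFin r) _ _ ⟩
          ∑F (λ x → T x - P x) + ∑F P
            ≈⟨ +-cong (∑-tabulate-single {m = r} (λ k → k) (λ x → T x - P x) xa (λ x x≢xa →
                 x≈y⇒x-y≈0 (shiftedDiffSum-off-diagonal m m<D a xa x x≢xa)))
               (∑-*ʳ (List.allFin r) (Hʲ m) _) ⟩
          (T xa - P xa) + ∑F (λ x → (F x - F xa) ↑ M) * Hʲ m
            ≈⟨ +-cong (+-cong (shiftedDiffSum-diagonal m a xa) (-‿cong P-diagonal))
              (*-congʳ (∑F-reindex (λ k → F k - F xa) (λ k → InFr-sub (F-root k) (F-root xa))
               (enumerates-translate (F xa)) (λ z → z ↑ M) (ScaledCong-↑ M))) ⟩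
          (diffSum m a - 0#) + powerSum M * Hʲ m
            ≈⟨ +-congʳ (trans (+-congˡ -0#≈0#) (+-identityʳ _)) ⟩
          diffSum m a + powerSum M * Hʲ m ∎
          where
          T = shiftedDiffSum m a xa
          P : Fin r → Carrier
          P x = (F x - F xa) ↑ M * Hʲ m
          P-diagonal : P xa ≈ 0#
          P-diagonal = trans (*-congʳ (trans (↑-cong M (-‿inverseʳ (F xa))) (0↑ (1≤invExponent j)))) (zeroˡ _)

        diffSum≈ : ∀ m → m ≤ D → ∀ a → diffSum m a ≈ powerSum M * Σ< m Hʲ
        diffSum≈ zero    _     [] = trans (+-identityʳ _) (trans (bracket⁻ʲ-zero (-‿inverseʳ 0#)) (sym (zeroʳ _)))
        diffSum≈ (suc m) 1+m≤D a with Vec.initLast a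
        ... | a′ , xa , Eq.refl = begin
          diffSum (suc m) (a′ Vec.∷ʳ xa)
            ≈⟨ ∑A<-∷ʳ m _ ⟩
          ∑A< m (λ b → ∑F (λ x → bracket⁻ʲ (Cpoly (suc m) (coeffs (b Vec.∷ʳ x)) - Cpoly (suc m) (coeffs (a′ Vec.∷ʳ xa)))))
            ≈⟨ ∑A<-cong m (λ b → ∑-cong (List.allFin r) (λ x → bracket⁻ʲ-cong (Cpoly-diff-∷ʳ a′ b xa x))) ⟩
          ∑A< m (λ b → ∑F (λ x → bracket⁻ʲ ((F x - F xa) * Cθ m + (Cpoly m (coeffs b) - Cpoly m (coeffs a′)))))
            ≈⟨ ∑A<-∑F-swap m _ ⟩
          ∑F (shiftedDiffSum m a′ xa)
            ≈⟨ ∑F-shiftedDiffSum m 1+m≤D a′ xa ⟩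
          diffSum m a′ + powerSum M * Hʲ m
            ≈⟨ +-congʳ (diffSum≈ m (ℕP.<⇒≤ 1+m≤D) a′) ⟩
          powerSum M * Σ< m Hʲ + powerSum M * Hʲ m
            ≈⟨ sym (distribˡ _ _ _) ⟩
          powerSum M * Σ< (suc m) Hʲ ∎

      module ProductFormula (d : ℕ) (d<D : d < D) (s₁′ s₂′ : ℕ) where

        s₁ s₂ N : ℕ
        s₁ = suc s₁′
        s₂ = suc s₂′
        N = s₁ ℕ.+ s₂

        0<D : 0 < D
        0<D = ℕP.≤-<-trans ℕ.z≤n d<D

        Hd : ℕ → Carrier
        Hd s = H r F θ d s u

        [_] : Vec (Fin r) d → Carrier
        [ a ] = (Cθ d + Cpoly d (coeffs a)) * u ⁻¹

        []-nonzero : ∀ a → Nonzero [ a ]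
        []-nonzero a = *-nonzero (Cmonic-nonzero d d<D (coeffs a) (FrSeq-coeffs a)) (⁻¹-nonzero (u≉0 0<D))

        []-diff : ∀ a b → [ b ] - [ a ] ≈ (Cpoly d (coeffs b) - Cpoly d (coeffs a)) * u ⁻¹
        []-diff a b = solve 4 (λ w lb la ui → (w :+ lb) :* ui :- (w :+ la) :* ui := (lb :- la) :* ui)
                              refl (Cθ d) (Cpoly d (coeffs b)) (Cpoly d (coeffs a)) (u ⁻¹)

        []-diff-nonzero : ∀ a b → ¬ b ≡ a → Nonzero ([ b ] - [ a ])
        []-diff-nonzero a b b≢a eq = *-nonzero (Cpoly-injective d (ℕP.<⇒≤ d<D) a b b≢a) (⁻¹-nonzero (u≉0 0<D)) (trans (sym ([]-diff a b)) eq)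

        κ : Vec (Fin r) d → Vec (Fin r) d → Carrier
        κ a b = ([ b ] - [ a ]) ⁻¹

        pf : Vec (Fin r) d → Vec (Fin r) d → Carrier
        pf a b = PartialFractions.partialFractionSum ([ a ] ⁻¹) ([ b ] ⁻¹) (κ a b) N s₁ s₂

        pf-diagonal : ∀ a → pf a a ≈ 0#
        pf-diagonal a = trans (Σ<-suc (s₁′ ℕ.+ s₂) _)
          (trans (+-cong first (Σ<-zero (s₁′ ℕ.+ s₂) _ (λ k _ → trans (*-congʳ (trans (*-congʳ κ≈0) (zeroˡ _))) (zeroˡ _))))
                 (+-identityˡ 0#))
          where
          κ≈0 : κ a a ≈ 0#
          κ≈0 = ⁻¹-zero (-‿inverseʳ [ a ])
          first = trans (*-identityˡ _) (trans (+-cong (trans (*-congʳ (zeroʳ _)) (zeroˡ _)) (trans (*-congʳ (zeroʳ _)) (zeroˡ _)))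
                                               (+-identityˡ 0#))

        row-sum : ∀ a → ∑A< d (λ b → [ a ] ⁻¹ ↑ s₁ * [ b ] ⁻¹ ↑ s₂) ≈ [ a ] ⁻¹ ↑ N + ∑A< d (pf a)
        row-sum a = begin
          ∑A< d (λ b → [ a ] ⁻¹ ↑ s₁ * [ b ] ⁻¹ ↑ s₂)
            ≈⟨ ∑A<-cong d (λ b → solve 2 (λ x y → x := (x :- y) :+ y) refl _ (pf a b)) ⟩
          ∑A< d (λ b → ([ a ] ⁻¹ ↑ s₁ * [ b ] ⁻¹ ↑ s₂ - pf a b) + pf a b)
            ≈⟨ ∑-+ (allVecs r d) _ _ ⟩
          ∑A< d (λ b → [ a ] ⁻¹ ↑ s₁ * [ b ] ⁻¹ ↑ s₂ - pf a b) + ∑A< d (pf a)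
            ≈⟨ +-congʳ (∑A<-single d a _ off-diagonal) ⟩
          ([ a ] ⁻¹ ↑ s₁ * [ a ] ⁻¹ ↑ s₂ - pf a a) + ∑A< d (pf a)
            ≈⟨ +-congʳ (trans (+-cong (sym (↑-+ ([ a ] ⁻¹) s₁ s₂)) (-‿cong (pf-diagonal a)))
                 (trans (+-congˡ -0#≈0#) (+-identityʳ _))) ⟩
          [ a ] ⁻¹ ↑ N + ∑A< d (pf a) ∎
          where
          off-diagonal : ∀ b → ¬ b ≡ a → [ a ] ⁻¹ ↑ s₁ * [ b ] ⁻¹ ↑ s₂ - pf a b ≈ 0#
          off-diagonal b b≢a = x≈y⇒x-y≈0 (PartialFractions.partial-fractions _ _ _
            (⁻¹*⁻¹≈partial-fraction ([]-nonzero a) ([]-nonzero b) ([]-diff-nonzero a b b≢a)) s₁ s₂ (ℕ.s≤s ℕ.z≤n))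

        crossSum : Carrier
        crossSum = ∑A< d (λ a → ∑A< d (pf a))

        Hd-product-expansion : Hd s₁ * Hd s₂ ≈ Hd N + crossSum
        Hd-product-expansion = begin
          Hd s₁ * Hd s₂                                           ≈⟨ sym (∑-*ʳ (allVecs r d) _ _) ⟩
          ∑A< d (λ a → [ a ] ⁻¹ ↑ s₁ * Hd s₂)                     ≈⟨ ∑A<-cong d (λ a → sym (∑-*ˡ (allVecs r d) _ _)) ⟩
          ∑A< d (λ a → ∑A< d (λ b → [ a ] ⁻¹ ↑ s₁ * [ b ] ⁻¹ ↑ s₂)) ≈⟨ ∑A<-cong d row-sum ⟩
          ∑A< d (λ a → [ a ] ⁻¹ ↑ N + ∑A< d (pf a))                ≈⟨ ∑-+ (allVecs r d) _ _ ⟩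
          Hd N + crossSum                                         ∎

        α β : ℕ → Carrier
        α j = sign (j ℕ.+ s₂) * binom s₂ j ×1
        β j = sign s₁ * binom s₁ j ×1

        crossTerm : ℕ → Carrier
        crossTerm j = α j * ∑A< d (λ a → [ a ] ⁻¹ ↑ (N ℕ.∸ j) * ∑A< d (λ b → κ a b ↑ j))
                    + β j * ∑A< d (λ b → [ b ] ⁻¹ ↑ (N ℕ.∸ j) * ∑A< d (λ a → κ a b ↑ j))

        crossSum-by-power : crossSum ≈ Σ< N crossTerm
        crossSum-by-power = begin
          crossSum
            ≈⟨ ∑A<-cong d (λ a → ∑A<-cong d (λ b → Σ<-cong N (λ j _ →
                 solve 5 (λ c a b x y → c :* (a :* x :+ b :* y) := a :* (x :* c) :+ b :* (y :* c))
                   refl (κ a b ↑ j) (α j) (β j) ([ a ] ⁻¹ ↑ (N ℕ.∸ j)) ([ b ] ⁻¹ ↑ (N ℕ.∸ j))))) ⟩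
          ∑A< d (λ a → ∑A< d (λ b → Σ< N (λ j → term j a b)))
            ≈⟨ ∑A<-cong d (λ a → ∑-Σ<-swap (allVecs r d) N _) ⟩
          ∑A< d (λ a → Σ< N (λ j → ∑A< d (λ b → term j a b)))
            ≈⟨ ∑-Σ<-swap (allVecs r d) N _ ⟩
          Σ< N (λ j → ∑A< d (λ a → ∑A< d (λ b → term j a b)))
            ≈⟨ Σ<-cong N (λ j _ → sum-term j) ⟩
          Σ< N crossTerm ∎
          where
          V = allVecs r d
          term : ℕ → Vec (Fin r) d → Vec (Fin r) d → Carrier
          term j a b = α j * ([ a ] ⁻¹ ↑ (N ℕ.∸ j) * κ a b ↑ j) + β j * ([ b ] ⁻¹ ↑ (N ℕ.∸ j) * κ a b ↑ j)
          sum-term : ∀ j → ∑A< d (λ a → ∑A< d (λ b → term j a b)) ≈ crossTerm j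
          sum-term j = begin
            ∑A< d (λ a → ∑A< d (λ b → term j a b))
              ≈⟨ trans (∑A<-cong d (λ a → ∑-+ V _ _)) (∑-+ V _ _) ⟩
            ∑A< d (λ a → ∑A< d (λ b → α j * ([ a ] ⁻¹ ↑ (N ℕ.∸ j) * κ a b ↑ j)))
              + ∑A< d (λ a → ∑A< d (λ b → β j * ([ b ] ⁻¹ ↑ (N ℕ.∸ j) * κ a b ↑ j)))
              ≈⟨ +-cong
                (trans (∑A<-cong d (λ a → trans (∑-*ˡ V (α j) _) (*-congˡ (∑-*ˡ V ([ a ] ⁻¹ ↑ (N ℕ.∸ j)) _)))) (∑-*ˡ V (α j) _))
                (trans (∑-swap V V _) (trans (∑A<-cong d (λ b → trans (∑-*ˡ V (β j) _) (*-congˡ (∑-*ˡ V ([ b ] ⁻¹ ↑ (N ℕ.∸ j)) _)))) (∑-*ˡ V (β j) _))) ⟩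
            crossTerm j ∎

        module _ (k : ℕ) where

          private
            j = suc k

          open InversePowers j (ℕ.s≤s ℕ.z≤n)

          ∑κ↑j-right : ∀ a → ∑A< d (λ b → κ a b ↑ j) ≈ powerSum M * Σ< d Hʲ
          ∑κ↑j-right a = trans (∑A<-cong d (λ b → ↑-cong j (⁻¹-cong ([]-diff a b)))) (diffSum≈ d (ℕP.<⇒≤ d<D) a)

          κ-antisymmetric-↑ : ∀ a b → κ a b ↑ j ≈ sign j * κ b a ↑ j
          κ-antisymmetric-↑ a b with VecP.≡-dec FinP._≟_ a b
          ... | yes Eq.refl = trans κ↑j≈0 (sym (trans (*-congˡ κ↑j≈0) (zeroʳ _)))
            where
            κ↑j≈0 = trans (↑-cong j (⁻¹-zero (-‿inverseʳ [ a ]))) (zeroˡ _)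
          ... | no a≢b = begin
            (([ b ] - [ a ]) ⁻¹) ↑ j
              ≈⟨ ↑-cong j (⁻¹-cong (solve 2 (λ x y → y :- x := :- (x :- y)) refl [ a ] [ b ])) ⟩
            ((- ([ a ] - [ b ])) ⁻¹) ↑ j
              ≈⟨ ↑-cong j (trans (⁻¹-neg ([]-diff-nonzero b a a≢b)) (solve 1 (λ z → :- z := (:- con (+ 1)) :* z) refl _)) ⟩
            (- 1# * ([ a ] - [ b ]) ⁻¹) ↑ j
              ≈⟨ *-↑ _ _ j ⟩
            sign j * κ b a ↑ j ∎

          ∑κ↑j-left : ∀ b → ∑A< d (λ a → κ a b ↑ j) ≈ sign j * (powerSum M * Σ< d Hʲ)
          ∑κ↑j-left b = trans (∑A<-cong d (λ a → κ-antisymmetric-↑ a b)) (trans (∑-*ˡ (allVecs r d) (sign j) _) (*-congˡ (∑κ↑j-right b)))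

          crossTerm-value : crossTerm j ≈ ℤ→K (Δ r s₁ s₂ j) * Hd (N ℕ.∸ j) * Hlt r F θ d (j ∷ []) u
          crossTerm-value = begin
            crossTerm j
              ≈⟨ +-cong (*-congˡ (∑A<-cong d (λ a → *-congˡ (∑κ↑j-right a)))) (*-congˡ (∑A<-cong d (λ b → *-congˡ (∑κ↑j-left b)))) ⟩
            α j * ∑A< d (λ a → [ a ] ⁻¹ ↑ (N ℕ.∸ j) * (powerSum M * S)) + β j * ∑A< d (λ b → [ b ] ⁻¹ ↑ (N ℕ.∸ j) * (sign j * (powerSum M * S)))
              ≈⟨ +-cong (*-congˡ (∑-*ʳ (allVecs r d) _ _)) (*-congˡ (∑-*ʳ (allVecs r d) _ _)) ⟩
            α j * (Hd (N ℕ.∸ j) * (powerSum M * S)) + β j * (Hd (N ℕ.∸ j) * (sign j * (powerSum M * S)))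
              ≈⟨ solve 6 (λ a b h s p t → a :* (h :* (p :* s)) :+ b :* (h :* (t :* (p :* s))) := ((a :+ b :* t) :* p) :* h :* s)
                       refl (α j) (β j) (Hd (N ℕ.∸ j)) S (powerSum M) (sign j) ⟩
            ((α j + β j * sign j) * powerSum M) * Hd (N ℕ.∸ j) * S
              ≈⟨ *-cong (*-congʳ (Δ-value s₁′ s₂′ k)) (Σ<-cong d (λ _ _ → sym (*-identityʳ _))) ⟩
            ℤ→K (Δ r s₁ s₂ j) * Hd (N ℕ.∸ j) * Hlt r F θ d (j ∷ []) u ∎
            where
            S = Σ< d Hʲ

        Hd-product : Hd s₁ * Hd s₂
                     ≈ Hd N + ∑ (splits N) (λ ij → ℤ→K (Δ r s₁ s₂ (proj₂ ij)) * Hd (proj₁ ij) * Hlt r F θ d (proj₂ ij ∷ []) u)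
        Hd-product = begin
          Hd s₁ * Hd s₂
            ≈⟨ Hd-product-expansion ⟩
          Hd N + crossSum
            ≈⟨ +-congˡ crossSum-by-power ⟩
          Hd N + Σ< N crossTerm
            ≈⟨ +-congˡ (Σ<-suc (s₁′ ℕ.+ s₂) crossTerm) ⟩
          Hd N + (crossTerm 0 + Σ< (s₁′ ℕ.+ s₂) (λ k → crossTerm (suc k)))
            ≈⟨ +-congˡ (trans (+-congʳ crossTerm-0) (+-identityˡ _)) ⟩
          Hd N + Σ< (s₁′ ℕ.+ s₂) (λ k → crossTerm (suc k))
            ≈⟨ +-congˡ (trans (Σ<-cong (s₁′ ℕ.+ s₂) (λ k _ → crossTerm-value k)) (sym (∑-splits (s₁′ ℕ.+ s₂) _))) ⟩
          Hd N + ∑ (splits N) (λ ij → ℤ→K (Δ r s₁ s₂ (proj₂ ij)) * Hd (proj₁ ij) * Hlt r F θ d (proj₂ ij ∷ []) u) ∎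
          where
          crossTerm-0 : crossTerm 0 ≈ 0#
          crossTerm-0 = trans (+-cong (trans (*-congʳ (zeroʳ _)) (zeroˡ _)) (trans (*-congʳ (zeroʳ _)) (zeroˡ _))) (+-identityˡ 0#)

      -- The shuffle relation

      H< : ℕ → Word → Carrier
      H< d w = Hlt r F θ d w u

      Ĥ : ℕ → Lin → Carrier
      Ĥ d L = Hhat r F θ d L u

      Hₛ : ℕ → ℕ → Carrier
      Hₛ d s = H r F θ d s u

      Ĥ-++ : ∀ d L₁ L₂ → Ĥ d (L₁ ++ L₂) ≈ Ĥ d L₁ + Ĥ d L₂
      Ĥ-++ d L₁ L₂ = ∑-++ L₁ L₂ _

      Ĥ-scaleL : ∀ d a L → Ĥ d (scaleL a L) ≈ ℤ→K a * Ĥ d L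
      Ĥ-scaleL d a []            = sym (zeroʳ _)
      Ĥ-scaleL d a ((b , w) ∷ L) = trans (+-cong (trans (*-congʳ (ℤ→K-* a b)) (*-assoc _ _ _)) (Ĥ-scaleL d a L)) (sym (distribˡ _ _ _))

      Ĥ-concatMap : ∀ {A : Set} d (f : A → Lin) xs → Ĥ d (List.concatMap f xs) ≈ ∑ xs (λ x → Ĥ d (f x))
      Ĥ-concatMap d f xs = ∑-concatMap xs f _

      Ĥ-shL : ∀ d f L v → Ĥ d (shL r f L v) ≈ ∑ L (λ aw → ℤ→K (proj₁ aw) * Ĥ d (shW r f (proj₂ aw) v))
      Ĥ-shL d f []            v = refl
      Ĥ-shL d f ((a , w) ∷ L) v = trans (Ĥ-++ d (scaleL a (shW r f w v)) (shL r f L v)) (+-cong (Ĥ-scaleL d a (shW r f w v)) (Ĥ-shL d f L v))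

      Ĥ-single : ∀ d w → Ĥ d ((+ 1 , w) ∷ []) ≈ H< d w
      Ĥ-single d w = trans (+-identityʳ _) (trans (*-congʳ (+-identityʳ 1#)) (*-identityˡ _))

      Ĥ-prependL-zero : ∀ k L → Ĥ 0 (prependL k L) ≈ 0#
      Ĥ-prependL-zero k []            = refl
      Ĥ-prependL-zero k ((a , w) ∷ L) = trans (+-cong (zeroʳ _) (Ĥ-prependL-zero k L)) (+-identityˡ 0#)

      Ĥ-zero-++ : ∀ L₁ L₂ → Ĥ 0 L₁ ≈ 0# → Ĥ 0 L₂ ≈ 0# → Ĥ 0 (L₁ ++ L₂) ≈ 0#
      Ĥ-zero-++ L₁ L₂ L₁≈0 L₂≈0 = trans (Ĥ-++ 0 L₁ L₂) (trans (+-cong L₁≈0 L₂≈0) (+-identityˡ 0#))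

      -- H_{<d+1}(k ∷ w) = H_{<d}(k ∷ w) + H_d(k) H_{<d}(w): the increments below
      -- record what passing from d to d + 1 adds.
      Ĥ-prependL-suc : ∀ d k L → Ĥ (suc d) (prependL k L) ≈ Ĥ d (prependL k L) + Hₛ d k * Ĥ d L
      Ĥ-prependL-suc d k []            = sym (trans (+-congˡ (zeroʳ _)) (+-identityʳ 0#))
      Ĥ-prependL-suc d k ((a , w) ∷ L) = trans (+-cong (distribˡ _ _ _) (Ĥ-prependL-suc d k L))
        (solve 6 (λ A B a h hw E → (A :+ a :* (h :* hw)) :+ (B :+ h :* E) := (A :+ B) :+ h :* (a :* hw :+ E))
               refl (ℤ→K a * H< d (k ∷ w)) (Ĥ d (prependL k L)) (ℤ→K a) (Hₛ d k) (H< d w) (Ĥ d L))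

      Ĥ-suc-++ : ∀ d L₁ L₂ {E₁ E₂} → Ĥ (suc d) L₁ ≈ Ĥ d L₁ + E₁ → Ĥ (suc d) L₂ ≈ Ĥ d L₂ + E₂ →
                 Ĥ (suc d) (L₁ ++ L₂) ≈ Ĥ d (L₁ ++ L₂) + (E₁ + E₂)
      Ĥ-suc-++ d L₁ L₂ L₁≈ L₂≈ = trans (Ĥ-++ (suc d) L₁ L₂) (trans (+-cong L₁≈ L₂≈)
        (trans (solve 4 (λ a e b f → (a :+ e) :+ (b :+ f) := (a :+ b) :+ (e :+ f)) refl _ _ _ _) (+-congʳ (sym (Ĥ-++ d L₁ L₂)))))

      Ĥ-suc-scaleL : ∀ d a L {E} → Ĥ (suc d) L ≈ Ĥ d L + E → Ĥ (suc d) (scaleL a L) ≈ Ĥ d (scaleL a L) + ℤ→K a * E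
      Ĥ-suc-scaleL d a L L≈ = trans (Ĥ-scaleL (suc d) a L) (trans (*-congˡ L≈) (trans (distribˡ _ _ _) (+-congʳ (sym (Ĥ-scaleL d a L)))))

      Ĥ-suc-concatMap : ∀ {A : Set} d (f : A → Lin) (E : A → Carrier) xs → (∀ x → Ĥ (suc d) (f x) ≈ Ĥ d (f x) + E x) →
                        Ĥ (suc d) (List.concatMap f xs) ≈ Ĥ d (List.concatMap f xs) + ∑ xs E
      Ĥ-suc-concatMap d f E []       _  = sym (+-identityʳ _)
      Ĥ-suc-concatMap d f E (x ∷ xs) f≈ = Ĥ-suc-++ d (f x) _ (f≈ x) (Ĥ-suc-concatMap d f E xs f≈)

      Positive : Word → Set
      Positive = All (0 <_)

      WellFormed : ℕ → ℤ × Word → Set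
      WellFormed n (_ , w) = Positive w × length w ≤ n

      prependL-wellFormed : ∀ {n} k L → 0 < k → All (WellFormed n) L → All (WellFormed (suc n)) (prependL k L)
      prependL-wellFormed k []            _   All.[]                 = All.[]
      prependL-wellFormed k ((a , w) ∷ L) 0<k ((w-pos , w≤n) All.∷ L-wf) =
        (0<k All.∷ w-pos , ℕ.s≤s w≤n) All.∷ prependL-wellFormed k L 0<k L-wf

      scaleL-wellFormed : ∀ {n} a L → All (WellFormed n) L → All (WellFormed n) (scaleL a L)
      scaleL-wellFormed a []            All.[]           = All.[]
      scaleL-wellFormed a ((b , w) ∷ L) (wf All.∷ L-wf) = wf All.∷ scaleL-wellFormed a L L-wf

      wellFormed-weaken : ∀ {m n} → m ≤ n → ∀ {L} → All (WellFormed m) L → All (WellFormed n) L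
      wellFormed-weaken m≤n = All.map (λ { (w-pos , w≤m) → w-pos , ℕP.≤-trans w≤m m≤n })

      splits-positive : ∀ n → All (λ ij → 0 < proj₁ ij × 0 < proj₂ ij) (splits n)
      splits-positive n = AllP.map⁺ (AllP.applyUpTo⁺₁ (λ i → i) (n ℕ.∸ 1) (λ i<n-1 → ℕ.s≤s ℕ.z≤n , ℕP.m<n⇒0<n∸m (i<n n i<n-1)))
        where
        i<n : ∀ n {i} → i < n ℕ.∸ 1 → suc i < n
        i<n (suc n) i<n-1 = ℕ.s≤s i<n-1

      mutual
        shW-wellFormed : ∀ f R S → Positive R → Positive S → All (WellFormed (length R ℕ.+ length S)) (shW r f R S)
        shW-wellFormed f       []        S         _ S-pos = (S-pos , ℕP.≤-refl) All.∷ All.[]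
        shW-wellFormed f       (r₁ ∷ R⁻) []        R-pos _ = (R-pos , ℕP.≤-reflexive (Eq.sym (ℕP.+-identityʳ _))) All.∷ All.[]
        shW-wellFormed zero    (r₁ ∷ R⁻) (s₁ ∷ S⁻) _ _ = All.[]
        shW-wellFormed (suc f) (r₁ ∷ R⁻) (s₁ ∷ S⁻) (0<r₁ All.∷ R⁻-pos) (0<s₁ All.∷ S⁻-pos) =
          AllP.++⁺ (prependL-wellFormed r₁ _ 0<r₁ (shW-wellFormed f R⁻ (s₁ ∷ S⁻) R⁻-pos (0<s₁ All.∷ S⁻-pos)))
         (AllP.++⁺ (wellFormed-weaken (ℕP.≤-reflexive (Eq.cong suc (Eq.sym (ℕP.+-suc (length R⁻) (length S⁻)))))
                     (prependL-wellFormed s₁ _ 0<s₁ (shW-wellFormed f (r₁ ∷ R⁻) S⁻ (0<r₁ All.∷ R⁻-pos) S⁻-pos)))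
         (AllP.++⁺ (wellFormed-weaken (ℕ.s≤s (ℕP.≤-trans (ℕP.n≤1+n _) (ℕP.≤-reflexive (Eq.sym (ℕP.+-suc (length R⁻) (length S⁻))))))
                     (prependL-wellFormed (r₁ ℕ.+ s₁) _ (ℕP.<-≤-trans 0<r₁ (ℕP.m≤m+n r₁ s₁)) (shW-wellFormed f R⁻ S⁻ R⁻-pos S⁻-pos)))
           (AllP.concat⁺ (AllP.map⁺ (All.map (λ { {i , j} (0<i , 0<j) → scaleL-wellFormed (Δ r r₁ s₁ j) _
                            (wellFormed-weaken length-bound (prependL-wellFormed i _ 0<i
                              (shL-wellFormed f (shW r f R⁻ S⁻) (j ∷ []) (0<j All.∷ All.[]) (shW-wellFormed f R⁻ S⁻ R⁻-pos S⁻-pos)))) })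
                          (splits-positive (r₁ ℕ.+ s₁)))))))
          where
          length-bound : suc (length R⁻ ℕ.+ length S⁻ ℕ.+ 1) ≤ suc (length R⁻ ℕ.+ suc (length S⁻))
          length-bound = ℕ.s≤s (ℕP.≤-reflexive (Eq.trans (ℕP.+-assoc (length R⁻) (length S⁻) 1)
                                                         (Eq.cong (length R⁻ ℕ.+_) (ℕP.+-comm (length S⁻) 1))))

        shL-wellFormed : ∀ {m} f L v → Positive v → All (WellFormed m) L → All (WellFormed (m ℕ.+ length v)) (shL r f L v)
        shL-wellFormed f []            v _     All.[]                      = All.[]
        shL-wellFormed f ((a , w) ∷ L) v v-pos ((w-pos , w≤m) All.∷ L-wf) =
          AllP.++⁺ (scaleL-wellFormed a _ (wellFormed-weaken (ℕP.+-monoˡ-≤ (length v) w≤m) (shW-wellFormed f w v w-pos v-pos)))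
                   (shL-wellFormed f L v v-pos L-wf)

      ShuffleHom : ℕ → Set ℓ
      ShuffleHom f = ∀ R S → Positive R → Positive S → length R ℕ.+ length S ≤ f →
                     ∀ d → d ≤ D → Ĥ d (shW r f R S) ≈ H< d R * H< d S

      module ShuffleStep (f : ℕ) (IH : ShuffleHom f) (r₁′ s₁′ : ℕ) (R⁻ S⁻ : Word)
        (R⁻-pos : Positive R⁻) (S⁻-pos : Positive S⁻) (len : suc (length R⁻) ℕ.+ suc (length S⁻) ≤ suc f)
        where

        r₁ s₁ : ℕ
        r₁ = suc r₁′
        s₁ = suc s₁′

        R S : Word
        R = r₁ ∷ R⁻
        S = s₁ ∷ S⁻

        R-pos : Positive R
        R-pos = ℕ.s≤s ℕ.z≤n All.∷ R⁻-pos

        S-pos : Positive S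
        S-pos = ℕ.s≤s ℕ.z≤n All.∷ S⁻-pos

        X₁ X₂ X₃ : Lin
        X₁ = shW r f R⁻ S
        X₂ = shW r f R S⁻
        X₃ = shW r f R⁻ S⁻

        Y : ℕ → Lin
        Y j = shL r f X₃ (j ∷ [])

        len₁ : length R⁻ ℕ.+ length S ≤ f
        len₁ = ℕP.≤-pred len

        len₂ : length R ℕ.+ length S⁻ ≤ f
        len₂ = ℕP.≤-trans (ℕP.≤-reflexive (Eq.sym (ℕP.+-suc (length R⁻) (length S⁻)))) (ℕP.≤-pred len)

        len₃ : length R⁻ ℕ.+ length S⁻ ≤ f
        len₃ = ℕP.≤-trans (ℕP.n≤1+n _) len₂

        Ĥ-Y : ∀ d → d ≤ D → ∀ j → 0 < j → Ĥ d (Y j) ≈ Ĥ d X₃ * H< d (j ∷ [])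
        Ĥ-Y d d≤D j 0<j = begin
          Ĥ d (shL r f X₃ (j ∷ []))
            ≈⟨ Ĥ-shL d f X₃ (j ∷ []) ⟩
          ∑ X₃ (λ aw → ℤ→K (proj₁ aw) * Ĥ d (shW r f (proj₂ aw) (j ∷ [])))
            ≈⟨ ∑-cong-All (shW-wellFormed f R⁻ S⁻ R⁻-pos S⁻-pos)
                 (λ aw wf → *-congˡ (IH (proj₂ aw) (j ∷ []) (proj₁ wf) (0<j All.∷ All.[])
                    (length-bound {proj₂ aw} (proj₂ wf)) d d≤D)) ⟩
          ∑ X₃ (λ aw → ℤ→K (proj₁ aw) * (H< d (proj₂ aw) * H< d (j ∷ [])))
            ≈⟨ ∑-cong X₃ (λ aw → sym (*-assoc _ _ _)) ⟩
          ∑ X₃ (λ aw → ℤ→K (proj₁ aw) * H< d (proj₂ aw) * H< d (j ∷ []))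
            ≈⟨ ∑-*ʳ X₃ _ _ ⟩
          Ĥ d X₃ * H< d (j ∷ []) ∎
          where
          length-bound : ∀ {w : Word} → length w ≤ length R⁻ ℕ.+ length S⁻ → length w ℕ.+ 1 ≤ f
          length-bound w≤ = ℕP.≤-trans (ℕP.≤-reflexive (ℕP.+-comm _ 1)) (ℕP.≤-trans (ℕ.s≤s w≤) len₂)

        splitTerms : ℕ → Carrier
        splitTerms d = ∑ (splits (r₁ ℕ.+ s₁)) (λ ij → ℤ→K (Δ r r₁ s₁ (proj₂ ij)) * (Hₛ d (proj₁ ij) * Ĥ d (Y (proj₂ ij))))

        Ĥ-suc-shW : ∀ d → Ĥ (suc d) (shW r (suc f) R S)
                          ≈ Ĥ d (shW r (suc f) R S) + (Hₛ d r₁ * Ĥ d X₁ + (Hₛ d s₁ * Ĥ d X₂ + (Hₛ d (r₁ ℕ.+ s₁) * Ĥ d X₃ + splitTerms d)))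
        Ĥ-suc-shW d = Ĥ-suc-++ d (prependL r₁ X₁) _ (Ĥ-prependL-suc d r₁ X₁) (Ĥ-suc-++ d (prependL s₁ X₂) _ (Ĥ-prependL-suc d s₁ X₂)
          (Ĥ-suc-++ d (prependL (r₁ ℕ.+ s₁) X₃) _ (Ĥ-prependL-suc d (r₁ ℕ.+ s₁) X₃)
            (Ĥ-suc-concatMap d _ _ (splits (r₁ ℕ.+ s₁)) (λ { (i , j) → Ĥ-suc-scaleL d (Δ r r₁ s₁ j) (prependL i (Y j)) (Ĥ-prependL-suc d i (Y j)) }))))

        Ĥ-zero-shW : Ĥ 0 (shW r (suc f) R S) ≈ 0#
        Ĥ-zero-shW = Ĥ-zero-++ (prependL r₁ X₁) _ (Ĥ-prependL-zero r₁ X₁) (Ĥ-zero-++ (prependL s₁ X₂) _ (Ĥ-prependL-zero s₁ X₂)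
          (Ĥ-zero-++ (prependL (r₁ ℕ.+ s₁) X₃) _ (Ĥ-prependL-zero (r₁ ℕ.+ s₁) X₃)
            (trans (Ĥ-concatMap 0 _ (splits (r₁ ℕ.+ s₁)))
                   (∑-zero (splits (r₁ ℕ.+ s₁)) _ (λ { (i , j) → trans (Ĥ-scaleL 0 (Δ r r₁ s₁ j) (prependL i (Y j)))
                                                         (trans (*-congˡ (Ĥ-prependL-zero i (Y j))) (zeroʳ _)) })))))

        Ĥ-shW-step : ∀ d → d ≤ D → Ĥ d (shW r (suc f) R S) ≈ H< d R * H< d S
        Ĥ-shW-step zero    _     = trans Ĥ-zero-shW (sym (zeroˡ _))
        Ĥ-shW-step (suc d) 1+d≤D = begin
          Ĥ (suc d) (shW r (suc f) R S)
            ≈⟨ Ĥ-suc-shW d ⟩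
          Ĥ d (shW r (suc f) R S) + (h₁ * Ĥ d X₁ + (h₂ * Ĥ d X₂ + (Hₛ d (r₁ ℕ.+ s₁) * Ĥ d X₃ + splitTerms d)))
            ≈⟨ +-cong (Ĥ-shW-step d d≤D) (+-cong (*-congˡ (IH R⁻ S R⁻-pos S-pos len₁ d d≤D))
                 (+-cong (*-congˡ (IH R S⁻ R-pos S⁻-pos len₂ d d≤D)) (+-cong (*-congˡ (IH R⁻ S⁻ R⁻-pos S⁻-pos len₃ d d≤D)) splitTerms≈))) ⟩
          A * B + (h₁ * (a * B) + (h₂ * (A * b) + (Hₛ d (r₁ ℕ.+ s₁) * (a * b) + Σ₁ * (a * b))))
            ≈⟨ +-congˡ (+-congˡ (+-congˡ (trans (sym (distribʳ _ _ _)) (*-congʳ (sym Hd-product))))) ⟩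
          A * B + (h₁ * (a * B) + (h₂ * (A * b) + (h₁ * h₂) * (a * b)))
            ≈⟨ solve 6 (λ A B a b h₁ h₂ → A :* B :+ (h₁ :* (a :* B) :+ (h₂ :* (A :* b) :+ (h₁ :* h₂) :* (a :* b)))
                                          := (A :+ h₁ :* a) :* (B :+ h₂ :* b)) refl A B a b h₁ h₂ ⟩
          H< (suc d) R * H< (suc d) S ∎
          where
          d≤D = ℕP.<⇒≤ 1+d≤D
          A = H< d R
          B = H< d S
          a = H< d R⁻
          b = H< d S⁻
          h₁ = Hₛ d r₁
          h₂ = Hₛ d s₁
          open ProductFormula d 1+d≤D r₁′ s₁′ using (Hd-product)
          Σ₁ = ∑ (splits (r₁ ℕ.+ s₁)) (λ ij → ℤ→K (Δ r r₁ s₁ (proj₂ ij)) * Hₛ d (proj₁ ij) * H< d (proj₂ ij ∷ []))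
          splitTerms≈ : splitTerms d ≈ Σ₁ * (a * b)
          splitTerms≈ = begin
            splitTerms d
              ≈⟨ ∑-cong-All (splits-positive (r₁ ℕ.+ s₁)) (λ ij pos → *-congˡ (*-congˡ
                   (trans (Ĥ-Y d d≤D (proj₂ ij) (proj₂ pos)) (*-congʳ (IH R⁻ S⁻ R⁻-pos S⁻-pos len₃ d d≤D))))) ⟩
            ∑ (splits (r₁ ℕ.+ s₁)) (λ ij → ℤ→K (Δ r r₁ s₁ (proj₂ ij)) * (Hₛ d (proj₁ ij) * ((a * b) * H< d (proj₂ ij ∷ []))))
              ≈⟨ ∑-cong (splits (r₁ ℕ.+ s₁)) (λ ij → solve 4 (λ x y z w → x :* (y :* (z :* w)) := x :* y :* w :* z) refl _ _ (a * b) _) ⟩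
            ∑ (splits (r₁ ℕ.+ s₁)) (λ ij → ℤ→K (Δ r r₁ s₁ (proj₂ ij)) * Hₛ d (proj₁ ij) * H< d (proj₂ ij ∷ []) * (a * b))
              ≈⟨ ∑-*ʳ (splits (r₁ ℕ.+ s₁)) _ _ ⟩
            Σ₁ * (a * b) ∎

      Ĥ-shW : ∀ f → ShuffleHom f
      Ĥ-shW f       []        S         _ _ _ d _ = trans (Ĥ-single d S) (sym (*-identityˡ _))
      Ĥ-shW f       (r₁ ∷ R⁻) []        _ _ _ d _ = trans (Ĥ-single d (r₁ ∷ R⁻)) (sym (*-identityʳ _))
      Ĥ-shW (suc f) (suc r₁′ ∷ R⁻) (suc s₁′ ∷ S⁻) (_ All.∷ R⁻-pos) (_ All.∷ S⁻-pos) len =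
        ShuffleStep.Ĥ-shW-step f (Ĥ-shW f) r₁′ s₁′ R⁻ S⁻ R⁻-pos S⁻-pos len

corollary3p12 :
    ∀ {c ℓ} (K : Field c ℓ) →
    let open Field K
        open Carlitz K
    in
    (p n r : ℕ) → Prime p → 1 ≤ n → r ≡ p ^ n →
    (p ×1) ≈ 0# →
    (F : Fin r → Carrier) →
    (∀ i j → F i ≈ F j → i ≡ j) →
    (∀ i → F i ↑ r ≈ F i) →
    (θ : Carrier) →
    (∀ m (cs : Vec (Fin r) m) → evalPoly r F θ cs ≈ 0# → ∀ k → F (lookup cs k) ≈ 0#) →
    (d : ℕ) (u : Carrier) →
    (∀ e → e < d → (cs : Vec (Fin r) e) → ¬ (Cmonic r F θ cs u ≈ 0#)) →
    ∀ (rr ss : Word) → All (0 <_) rr → All (0 <_) ss →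
    Hhat r F θ d (rr ∗[ r ] ss) u ≈ Hlt r F θ d rr u * Hlt r F θ d ss u
corollary3p12 K p n r p-prime 1≤n r≡p^n char-p F F-injective F-root θ _ d u Cmonic≉0 rr ss rr-pos ss-pos
  with ℕP.m≤n⇒∃[o]m+o≡n 2≤p | ℕP.m≤n⇒∃[o]m+o≡n 2≤r
  where
  2≤p : 2 ≤ p
  2≤p = nonTrivial⇒n>1 p {{prime⇒nonTrivial p-prime}}
  2≤r : 2 ≤ r
  2≤r = Eq.subst (2 ≤_) (Eq.sym r≡p^n) (ℕP.^-monoʳ-< p 2≤p 1≤n)
... | q , Eq.refl | r-2 , Eq.refl =
  Ĥ-shW (length rr ℕ.+ length ss) rr ss rr-pos ss-pos ℕP.≤-refl d ℕP.≤-refl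
  where
  open OverField K
  r≈0 : 2+ r-2 ×1 ≈ 0#
  r≈0 = ∣⇒×1≈0 char-p (Eq.subst (2+ q ∣_) (Eq.sym r≡p^n) (p∣p^n 1≤n))
    where
    p∣p^n : ∀ {n} → 1 ≤ n → 2+ q ∣ 2+ q ^ n
    p∣p^n {suc n} _ = m∣m*n (2+ q ^ n)
  frobenius-r : ∀ x y → (x + y) ↑ 2+ r-2 ≈ x ↑ 2+ r-2 + y ↑ 2+ r-2
  frobenius-r = Eq.subst (λ m → ∀ x y → (x + y) ↑ m ≈ x ↑ m + y ↑ m) (Eq.sym r≡p^n) (frobenius-↑^ p-prime char-p n)
  open FiniteSubfield r-2 r≈0 frobenius-r F F-injective F-root
  open CarlitzSums θ u d Cmonic≉0
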